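{- Let $R$ be a commutative ring, $A,B$ finite $R$-modules with $A\ne 0$, $C$ a cyclic group of odd order $r$, and $\lambda:A\times B\to C$ a $\mathbb{Z}$-bilinear, $R$-balanced, non-degenerate pairing; let $\mathcal{H}=\mathcal{H}(A,B,C,\lambda)$. Consider the diagram whose top row is the exact sequence $1\to\mathrm{Inn}(\mathcal{H})\to\mathrm{Aut}^0_R(\mathcal{H})\to\mathrm{Out}^0_R(\mathcal{H})\to 1$, whose bottom row is $1\to\mathrm{Hom}(A\oplus B,C)\to\mathrm{Hom}(A\oplus B,C)\rtimes\mathrm{Sp}_R(A\oplus B;\delta)\to\mathrm{Sp}_R(A\oplus B;\delta)\to1$ (with the obvious inclusion $\eta\mapsto(\eta,\mathrm{id})$ and projection), and whose vertical maps are $\Theta_1:\mathrm{Inn}(\mathcal{H})\to\mathrm{Hom}(A\oplus B,C)$, $\phi_h\mapsto\eta_{\phi_h}$; $\Theta_{\mathcal{D}}:\phi\mapsto(\eta_\phi,\bar\phi^{ -1})$; and $\tilde\Theta:\mathrm{Out}^0_R(\mathcal{H})\to\mathrm{Sp}_R(A\oplus B;\delta)$, $\hat\phi\mapsto\bar\phi^{ -1}$. Then this diagram commutes and has exact rows, and all three vertical maps are well-defined anti-isomorphisms. Moreover the map $\bar\Theta:\mathrm{Out}^0_R(\mathcal{H})\to\mathrm{Sp}_R(A\oplus B;\delta)$, $\hat\phi\mapsto\bar\phi$, is a group isomorphism.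
   Context: $\mathcal{H}(A,B,C,\lambda)$ is the set $A\times B\times C$, elements $h(a,b,c)$, multiplication $h(a,b,c)h(a',b',c')=h(a+a',b+b',c+c'+\lambda(a,b'))$. $R$-balanced: $\lambda(ra,b)=\lambda(a,rb)$; non-degenerate: trivial left and right kernels. $m:C\to\mathcal{H}$, $c\mapsto h(0,0,c)$; here $m(C)=Z(\mathcal{H})$ and $\mathcal{H}/Z(\mathcal{H})$ is identified with $A\oplus B$. For $\phi\in\mathrm{Aut}(\mathcal{H})$, $\bar\phi$ denotes the induced automorphism of $A\oplus B$ and $\hat\phi$ its class in outer automorphisms. $\mathrm{Aut}^0_R(\mathcal{H})$: automorphisms fixing $Z(\mathcal{H})$ elementwise with $\bar\phi$ $R$-linear; it contains $\mathrm{Inn}(\mathcal{H})$, and $\mathrm{Out}^0_R(\mathcal{H})=\mathrm{Aut}^0_R(\mathcal{H})/\mathrm{Inn}(\mathcal{H})$. $\phi_h$ is conjugation $g\mapsto hgh^{ -1}$. $\delta((a,b),(a',b'))=\lambda(a,b')-\lambda(a',b)$; $\mathrm{Sp}_R(A\oplus B;\delta)$ is the group of $R$-linear automorphisms of $A\oplus B$ preserving $\delta$. $\mathcal{D}((a,b))=h(a,b,\tfrac12\lambda(a,b))$ (halving in the odd-order group $C$), and $\eta_\phi:A\oplus B\to C$ is defined by $\phi(\mathcal{D}(\mathbf{a}))=\mathcal{D}(\bar\phi(\mathbf{a}))m(\eta_\phi(\mathbf{a}))$. The semidirect product has multiplication $(\eta_1,\alpha_1)(\eta_2,\alpha_2)=(\eta_1+\eta_2\circ\alpha_1^{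 -1},\alpha_1\alpha_2)$. An anti-isomorphism is a bijection reversing the order of products. -}

module Defs where

open import Level using (0ℓ; _⊔_) renaming (suc to lsuc)
open import Algebra.Bundles using (CommutativeRing; AbelianGroup)
open import Algebra.Module.Bundles using (Module)
open import Data.Nat using (ℕ; zero; suc; _%_; ⌊_/2⌋)
open import Data.Integer using (ℤ; +_; -[1+_])
open import Data.Fin using (Fin)
open import Data.Product using (Σ; ∃; _×_; _,_; proj₁; proj₂)
open import Function.Bundles using (_↔_)
open import Relation.Binary.PropositionalEquality using (_≡_)
open import Relation.Nullary using (¬_)

Finite : Set → Set
Finite X = Σ ℕ λ n → X ↔ Fin n

ModuleOnSet : ∀ {c ℓ} {R : CommutativeRing c ℓ} → Module R 0ℓ 0ℓ → Set
ModuleOnSet M = ∀ {x y} → x ≈ᴹ y → x ≡ y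
  where open Module M

GroupOnSet : AbelianGroup 0ℓ 0ℓ → Set
GroupOnSet G = ∀ {x y} → x ≈ y → x ≡ y
  where open AbelianGroup G

FiniteModule : ∀ {c ℓ} {R : CommutativeRing c ℓ} → Module R 0ℓ 0ℓ → Set
FiniteModule M = ModuleOnSet M × Finite (Module.Carrierᴹ M)

-- n-fold and integer multiples in an abelian group (written multiplicatively
-- in the stdlib bundle, additively in the paper).
module _ (G : AbelianGroup 0ℓ 0ℓ) where
  open AbelianGroup G
  natMul : ℕ → Carrier → Carrier
  natMul zero    x = ε
  natMul (suc n) x = x ∙ natMul n x

  intMul : ℤ → Carrier → Carrier
  intMul (+ n)      x = natMul n x
  intMul -[1+ n ]   x = (natMul (suc n) x) ⁻¹

IsCyclicOfOrder : AbelianGroup 0ℓ 0ℓ → ℕ → Set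
IsCyclicOfOrder G r =
  GroupOnSet G
  × (Σ Carrier λ g → ∀ x → Σ ℤ λ k → x ≡ intMul G k g)
  × (Carrier ↔ Fin r)
  where open AbelianGroup G

Odd : ℕ → Set
Odd r = r % 2 ≡ 1

module Heisenberg {c ℓ} (R : CommutativeRing c ℓ)
                  (A B : Module R 0ℓ 0ℓ) (C : AbelianGroup 0ℓ 0ℓ)
                  (r : ℕ)
                  (lam : Module.Carrierᴹ A → Module.Carrierᴹ B → AbelianGroup.Carrier C)
                  where
  module RR = CommutativeRing R
  module A = Module A
  module B = Module B
  module C = AbelianGroup C
  open C using () renaming (_∙_ to _+C_; ε to 0C; _⁻¹ to -C_)

  Biadditive : Set
  Biadditive = (∀ a a' b → lam (a A.+ᴹ a') b ≡ lam a b +C lam a' b)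
             × (∀ a b b' → lam a (b B.+ᴹ b') ≡ lam a b +C lam a b')

  Balanced : Set (c)
  Balanced = ∀ (s : RR.Carrier) a b → lam (s A.*ₗ a) b ≡ lam a (s B.*ₗ b)

  NonDegenerate : Set
  NonDegenerate = (∀ a → (∀ b → lam a b ≡ 0C) → a ≡ A.0ᴹ)
                × (∀ b → (∀ a → lam a b ≡ 0C) → b ≡ B.0ᴹ)

  -- halving in the odd-order group C of order r: c ↦ ((r+1)/2)·c
  half : C.Carrier → C.Carrier
  half x = natMul C ⌊ suc r /2⌋ x

  H : Set
  H = A.Carrierᴹ × B.Carrierᴹ × C.Carrier

  h : A.Carrierᴹ → B.Carrierᴹ → C.Carrier → H
  h a b z = a , b , z

  _·_ : H → H → H
  (a , b , z) · (a' , b' , z') = h (a A.+ᴹ a') (b B.+ᴹ b') ((z +C z') +C lam a b')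

  infixl 7 _·_

  inv : H → H
  inv (a , b , z) = h (A.-ᴹ a) (B.-ᴹ b) ((-C z) +C lam a b)

  m : C.Carrier → H
  m z = h A.0ᴹ B.0ᴹ z

  -- A ⊕ B  ( = H / Z(H) )
  AB : Set
  AB = A.Carrierᴹ × B.Carrierᴹ

  _+AB_ : AB → AB → AB
  (a , b) +AB (a' , b') = (a A.+ᴹ a') , (b B.+ᴹ b')

  _*AB_ : RR.Carrier → AB → AB
  s *AB (a , b) = (s A.*ₗ a) , (s B.*ₗ b)

  δ : AB → AB → C.Carrier
  δ (a , b) (a' , b') = lam a b' +C (-C (lam a' b))

  π : H → AB
  π (a , b , _) = a , b

  bar : (H → H) → AB → AB
  bar f (a , b) = π (f (h a b 0C))

  D : AB → H
  D (a , b) = h a b (half (lam a b))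

  -- η_f : A ⊕ B → C, the unique element with f(D x) = D(f̄ x) m(η_f x)
  -- i.e. m(η_f x) = D(f̄ x)⁻¹ f(D x).
  eta : (H → H) → AB → C.Carrier
  eta f x = proj₂ (proj₂ (inv (D (bar f x)) · f (D x)))

  record Aut : Set where
    field
      to   : H → H
      from : H → H
      from∘to : ∀ g → from (to g) ≡ g
      to∘from : ∀ g → to (from g) ≡ g
      hom  : ∀ g g' → to (g · g') ≡ to g · to g'
  open Aut public

  _≈Aut_ : Aut → Aut → Set
  φ ≈Aut ψ = ∀ g → to φ g ≡ to ψ g

  IsRLinear : (AB → AB) → Set c
  IsRLinear f = (∀ x y → f (x +AB y) ≡ f x +AB f y)
              × (∀ (s : RR.Carrier) x → f (s *AB x) ≡ s *AB f x)

  IsAut0 : Aut → Set c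
  IsAut0 φ = (∀ z → to φ (m z) ≡ m z) × IsRLinear (bar (to φ))

  record Aut0 : Set c where
    field
      aut    : Aut
      isAut0 : IsAut0 aut
  open Aut0 public

  record Inn : Set where
    field
      innAut    : Aut
      conjugator : H
      isConj    : ∀ g → to innAut g ≡ conjugator · g · inv conjugator
  open Inn public

  -- Out⁰_R(H) = Aut⁰_R(H)/Inn(H): equality modulo inner automorphisms
  _≈Out_ : Aut0 → Aut0 → Set
  φ ≈Out ψ = Σ Inn λ χ → ∀ g → to (aut φ) g ≡ to (innAut χ) (to (aut ψ) g)

  IsHom : (AB → C.Carrier) → Set
  IsHom η = ∀ x y → η (x +AB y) ≡ η x +C η y

  _≈Hom_ : (AB → C.Carrier) → (AB → C.Carrier) → Set
  η ≈Hom η' = ∀ x → η x ≡ η' x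

  _+Hom_ : (AB → C.Carrier) → (AB → C.Carrier) → AB → C.Carrier
  (η +Hom η') x = η x +C η' x

  record ABMap : Set where
    field
      fw : AB → AB
      bw : AB → AB
  open ABMap public

  IsSp : ABMap → Set c
  IsSp α = (∀ x → bw α (fw α x) ≡ x) × (∀ x → fw α (bw α x) ≡ x)
         × IsRLinear (fw α)
         × (∀ x y → δ (fw α x) (fw α y) ≡ δ x y)

  _≈Sp_ : ABMap → ABMap → Set
  α ≈Sp β = ∀ x → fw α x ≡ fw β x

  _∘Sp_ : ABMap → ABMap → ABMap
  α ∘Sp β = record { fw = λ x → fw α (fw β x) ; bw = λ x → bw β (bw α x) }

  idSp : ABMap
  idSp = record { fw = λ x → x ; bw = λ x → x }

  SD : Set
  SD = (AB → C.Carrier) × ABMap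

  IsSD : SD → Set c
  IsSD (η , α) = IsHom η × IsSp α

  _≈SD_ : SD → SD → Set
  (η , α) ≈SD (η' , α') = η ≈Hom η' × α ≈Sp α'

  _⋆_ : SD → SD → SD
  (η₁ , α₁) ⋆ (η₂ , α₂) = (λ x → η₁ x +C η₂ (bw α₁ x)) , (α₁ ∘Sp α₂)

  inclSD : (AB → C.Carrier) → SD
  inclSD η = η , idSp

  projSD : SD → ABMap
  projSD = proj₂

  barMap : Aut → ABMap
  barMap φ = record { fw = bar (to φ) ; bw = bar (from φ) }

  barInvMap : Aut → ABMap
  barInvMap φ = record { fw = bar (from φ) ; bw = bar (to φ) }

  Θ₁ : Inn → (AB → C.Carrier)
  Θ₁ χ = eta (to (innAut χ))

  Θ𝒟 : Aut0 → SD
  Θ𝒟 φ = eta (to (aut φ)) , barInvMap (aut φ)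

  Θ̃ : Aut0 → ABMap
  Θ̃ φ = barInvMap (aut φ)

  Θ̄ : Aut0 → ABMap
  Θ̄ φ = barMap (aut φ)

  -- Generic: f is a well-defined anti-isomorphism (resp. isomorphism)
  -- between "groups" given by carrier, equality, and product.
  -- "compose χ φ ψ" says χ = φψ in the source.
  record AntiIso {l₁ l₂ l₃ l₄ l₅ l₆} (X : Set l₁) (_≈X_ : X → X → Set l₂)
                 (IsComp : X → X → X → Set l₃)
                 (Y : Set l₄) (InY : Y → Set l₅) (_≈Y_ : Y → Y → Set l₆)
                 (_∙Y_ : Y → Y → Y) (f : X → Y)
                 : Set (l₁ ⊔ l₂ ⊔ l₃ ⊔ l₄ ⊔ l₅ ⊔ l₆) where
    field
      lands     : ∀ x → InY (f x)
      respects  : ∀ x x' → x ≈X x' → f x ≈Y f x'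
      antiHom   : ∀ χ φ ψ → IsComp χ φ ψ → f χ ≈Y (f ψ ∙Y f φ)
      injective : ∀ x x' → f x ≈Y f x' → x ≈X x'
      surjective : ∀ y → InY y → Σ X λ x → f x ≈Y y

  record Iso {l₁ l₂ l₃ l₄ l₅ l₆} (X : Set l₁) (_≈X_ : X → X → Set l₂)
             (IsComp : X → X → X → Set l₃)
             (Y : Set l₄) (InY : Y → Set l₅) (_≈Y_ : Y → Y → Set l₆)
             (_∙Y_ : Y → Y → Y) (f : X → Y)
             : Set (l₁ ⊔ l₂ ⊔ l₃ ⊔ l₄ ⊔ l₅ ⊔ l₆) where
    field
      lands     : ∀ x → InY (f x)
      respects  : ∀ x x' → x ≈X x' → f x ≈Y f x'
      hom       : ∀ χ φ ψ → IsComp χ φ ψ → f χ ≈Y (f φ ∙Y f ψ)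
      injective : ∀ x x' → f x ≈Y f x' → x ≈X x'
      surjective : ∀ y → InY y → Σ X λ x → f x ≈Y y

  CompInn : Inn → Inn → Inn → Set
  CompInn χ φ ψ = ∀ g → to (innAut χ) g ≡ to (innAut φ) (to (innAut ψ) g)

  CompAut0 : Aut0 → Aut0 → Aut0 → Set
  CompAut0 χ φ ψ = ∀ g → to (aut χ) g ≡ to (aut φ) (to (aut ψ) g)

  Theorem6p3Conclusion : Set c
  Theorem6p3Conclusion =
      -- top row exact: Inn(H) ⊆ Aut⁰_R(H) (inclusion well defined, injective
      -- on the nose), Inn(H) normal in Aut⁰_R(H) (so Out⁰_R(H) is a group),
      -- kernel of Aut⁰ → Out⁰ equals the image of Inn; Aut⁰ → Out⁰ is onto
      -- (tautological, as Out⁰ is Aut⁰ with coarser equality).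
      (∀ χ → IsAut0 (innAut χ))
    × (∀ (φ : Aut0) (χ : Inn) → Σ H λ k →
         ∀ g → to (aut φ) (to (innAut χ) (from (aut φ) g)) ≡ k · g · inv k)
    × (∀ (φ ψ : Aut0) → (∀ g → to (aut ψ) g ≡ g) →
         (φ ≈Out ψ) → Σ Inn λ χ → aut φ ≈Aut innAut χ)
    × (∀ (φ : Aut0) (χ : Inn) → aut φ ≈Aut innAut χ →
         (∀ (ψ : Aut0) → (∀ g → to (aut ψ) g ≡ g) → φ ≈Out ψ))
      -- bottom row exact: inclusion lands in the semidirect product, kernel of
      -- the projection is the image of the inclusion, projection is onto
      -- and multiplicative
    × (∀ η → IsHom η → IsSD (inclSD η))
    × (∀ s → IsSD s → projSD s ≈Sp idSp → Σ (AB → C.Carrier) λ η → IsHom η × s ≈SD inclSD η)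
    × (∀ η → projSD (inclSD η) ≈Sp idSp)
    × (∀ α → IsSp α → Σ SD λ s → IsSD s × projSD s ≈Sp α)
    × (∀ s t → projSD (s ⋆ t) ≈Sp (projSD s ∘Sp projSD t))
    × (∀ (χ : Inn) (χ' : Aut0) → aut χ' ≈Aut innAut χ → Θ𝒟 χ' ≈SD inclSD (Θ₁ χ))
    × (∀ (φ : Aut0) → projSD (Θ𝒟 φ) ≈Sp Θ̃ φ)
    × AntiIso Inn (λ χ χ' → innAut χ ≈Aut innAut χ') CompInn
              (AB → C.Carrier) IsHom _≈Hom_ _+Hom_ Θ₁
    × AntiIso Aut0 (λ φ ψ → aut φ ≈Aut aut ψ) CompAut0
              SD IsSD _≈SD_ _⋆_ Θ𝒟
    × AntiIso Aut0 _≈Out_ CompAut0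
              ABMap IsSp _≈Sp_ _∘Sp_ Θ̃
    × Iso Aut0 _≈Out_ CompAut0
          ABMap IsSp _≈Sp_ _∘Sp_ Θ̄

{-# OPTIONS --safe #-}
-- Write every element of H as D(x)·m(z) with x ∈ A ⊕ B and z ∈ C. Since 2 is invertible in C, the cocycle
-- λ(a, b′) differs from ½δ by the coboundary of ½λ(a, b), so in these coordinates
-- (x , z)(y , w) = (x + y , z + w + ½δ(x , y)). An endomorphism fixing the centre pointwise is then
-- (x , z) ↦ (φ̄ x , η_φ x + z), and it is multiplicative iff φ̄ is additive and preserves δ and η_φ is
-- additive: the defect η(x + y) − η x − η y equals ½δ(φ̄ x , φ̄ y) − ½δ(x , y), which is both symmetric and
-- antisymmetric in (x , y), hence zero. This identifies Aut⁰_R(H) with Hom(A ⊕ B, C) ⋊ Sp_R(A ⊕ B; δ), with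
-- the order of composition reversed, and the inner automorphisms with the pairs (δ(k , ·) , id).
-- That every homomorphism A ⊕ B → C is some δ(k , ·) is duality for the non-degenerate pairing λ: a finite
-- abelian group X has at most |X| distinct homomorphisms into the cyclic group C, so |A| = |B| and
-- a ↦ λ(a , ·) is onto Hom(B, C).
module Submission where

open import Level using (0ℓ)
open import Algebra.Bundles using (CommutativeRing; AbelianGroup)
import Algebra.Construct.DirectProduct as DirectProduct
open import Algebra.Module.Bundles using (Module)
open import Data.Empty using (⊥; ⊥-elim)
open import Data.Fin using (Fin; zero; suc; toℕ; fromℕ<; inject)
import Data.Fin.Properties as Fin
open import Data.Integer as ℤ using (ℤ; +_; -[1+_]; _⊖_)
import Data.Integer.Properties as ℤ
open import Data.List using (List; []; _∷_; length; filter; tabulate)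
import Data.List as List
import Data.List.Properties as List
open import Data.List.Membership.Propositional using (_∈_)
open import Data.List.Membership.Propositional.Properties using (∈-tabulate⁺)
open import Data.List.Relation.Unary.All as All using (All; []; _∷_)
import Data.List.Relation.Unary.All.Properties as All
open import Data.List.Relation.Unary.AllPairs as AllPairs using (AllPairs; []; _∷_)
import Data.List.Relation.Unary.AllPairs.Properties as AllPairs
open import Data.List.Relation.Unary.Any using (here; there)
open import Data.Nat as ℕ using (ℕ; zero; suc; ⌊_/2⌋)
import Data.Nat.Properties as ℕ
open import Data.Nat.DivMod using (_%_; _/_; m≡m%n+[m/n]*n; m%n<n; m<n*o⇒m/o<n)
open import Data.Product using (Σ; ∃; _,_; proj₁; proj₂)
import Data.Product as Product
open import Data.Product.Properties using (×-≡,≡→≡)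
open import Data.Sum using (_⊎_; inj₁; inj₂)
open import Data.Vec using (Vec; []; _∷_; replicate; zipWith; map)
open import Function.Base using (_∘_; id)
open import Function.Bundles using (_↔_; Inverse; Injection; mk↔ₛ′)
open import Function.Properties.Inverse using (↔⇒↣; ↔-sym)
open import Relation.Binary.Definitions using (DecidableEquality; tri<; tri≈; tri>)
open import Relation.Binary.PropositionalEquality as ≡ using (_≡_; _≗_)
open import Relation.Nullary using (¬_; yes; no)
open import Relation.Nullary.Decidable using (decidable-stable; ¬?; via-injection)
open import Relation.Unary using (Decidable)

open import Defs

-- Abelian groups

module AbelianGroupSolver {c ℓ} (G : AbelianGroup c ℓ) where

  open AbelianGroup G
  open import Algebra.Properties.AbelianGroup G
  open import Algebra.Properties.CommutativeSemigroup commutativeSemigroup using (interchange)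
  open import Algebra.Definitions.RawMonoid rawMonoid using (_×_)
  open import Algebra.Properties.Monoid.Mult monoid using (×-homo-+)
  open import Relation.Binary.Reasoning.Setoid setoid

  infixr 8 _·ℤ_

  _·ℤ_ : ℤ → Carrier → Carrier
  (+ n)    ·ℤ x = n × x
  -[1+ n ] ·ℤ x = (suc n × x) ⁻¹

  ·ℤ-homo-⊖ : ∀ m n x → (m ⊖ n) ·ℤ x ≈ m × x ∙ (n × x) ⁻¹
  ·ℤ-homo-⊖ m       zero    x = sym (trans (∙-congˡ ε⁻¹≈ε) (identityʳ _))
  ·ℤ-homo-⊖ zero    (suc n) x = sym (identityˡ _)
  ·ℤ-homo-⊖ (suc m) (suc n) x = begin
    (suc m ⊖ suc n) ·ℤ x               ≡⟨ ≡.cong (_·ℤ x) (ℤ.[1+m]⊖[1+n]≡m⊖n m n) ⟩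
    (m ⊖ n) ·ℤ x                       ≈⟨ ·ℤ-homo-⊖ m n x ⟩
    m × x ∙ (n × x) ⁻¹                 ≈⟨ identityˡ _ ⟨
    ε ∙ (m × x ∙ (n × x) ⁻¹)           ≈⟨ ∙-congʳ (inverseʳ x) ⟨
    x ∙ x ⁻¹ ∙ (m × x ∙ (n × x) ⁻¹)    ≈⟨ interchange x (x ⁻¹) (m × x) ((n × x) ⁻¹) ⟩
    x ∙ m × x ∙ (x ⁻¹ ∙ (n × x) ⁻¹)    ≈⟨ ∙-congˡ (⁻¹-∙-comm x (n × x)) ⟩
    x ∙ m × x ∙ (x ∙ n × x) ⁻¹         ∎

  ·ℤ-homo-+ : ∀ i j x → (i ℤ.+ j) ·ℤ x ≈ i ·ℤ x ∙ j ·ℤ x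
  ·ℤ-homo-+ -[1+ m ] -[1+ n ] x = begin
    (suc (suc m ℕ.+ n) × x) ⁻¹         ≡⟨ ≡.cong (λ k → (k × x) ⁻¹) (ℕ.+-suc (suc m) n) ⟨
    ((suc m ℕ.+ suc n) × x) ⁻¹         ≈⟨ ⁻¹-cong (×-homo-+ x (suc m) (suc n)) ⟩
    (suc m × x ∙ suc n × x) ⁻¹         ≈⟨ ⁻¹-∙-comm (suc m × x) (suc n × x) ⟨
    (suc m × x) ⁻¹ ∙ (suc n × x) ⁻¹    ∎
  ·ℤ-homo-+ -[1+ m ] (+ n)    x = trans (·ℤ-homo-⊖ n (suc m) x) (comm _ _)
  ·ℤ-homo-+ (+ m)    -[1+ n ] x = ·ℤ-homo-⊖ m (suc n) x
  ·ℤ-homo-+ (+ m)    (+ n)    x = ×-homo-+ x m n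

  ·ℤ-homo-neg : ∀ i x → (ℤ.- i) ·ℤ x ≈ (i ·ℤ x) ⁻¹
  ·ℤ-homo-neg -[1+ n ]    x = sym (⁻¹-involutive _)
  ·ℤ-homo-neg (+ zero)    x = sym ε⁻¹≈ε
  ·ℤ-homo-neg (+ (suc n)) x = refl

  infixl 6 _⊕_
  infix  8 ⊝_

  data Expr (n : ℕ) : Set where
    var : Fin n → Expr n
    𝟘   : Expr n
    _⊕_ : Expr n → Expr n → Expr n
    ⊝_  : Expr n → Expr n

  ⟦_⟧ : ∀ {n} → Expr n → Vec Carrier n → Carrier
  ⟦ var i ⟧ ρ = Data.Vec.lookup ρ i
  ⟦ 𝟘 ⟧     ρ = ε
  ⟦ e ⊕ f ⟧ ρ = ⟦ e ⟧ ρ ∙ ⟦ f ⟧ ρ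
  ⟦ ⊝ e ⟧   ρ = ⟦ e ⟧ ρ ⁻¹

  Normal : ℕ → Set
  Normal = Vec ℤ

  ⟦_⟧⇓ : ∀ {n} → Normal n → Vec Carrier n → Carrier
  ⟦ [] ⟧⇓    []      = ε
  ⟦ i ∷ v ⟧⇓ (x ∷ ρ) = i ·ℤ x ∙ ⟦ v ⟧⇓ ρ

  basis : ∀ {n} → Fin n → Normal n
  basis zero    = ℤ.1ℤ ∷ replicate _ ℤ.0ℤ
  basis (suc i) = ℤ.0ℤ ∷ basis i

  normalise : ∀ {n} → Expr n → Normal n
  normalise (var i) = basis i
  normalise 𝟘       = replicate _ ℤ.0ℤ
  normalise (e ⊕ f) = zipWith ℤ._+_ (normalise e) (normalise f)
  normalise (⊝ e)   = map ℤ.-_ (normalise e)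

  ⟦0⟧⇓ : ∀ {n} (ρ : Vec Carrier n) → ⟦ replicate n ℤ.0ℤ ⟧⇓ ρ ≈ ε
  ⟦0⟧⇓ []      = refl
  ⟦0⟧⇓ (x ∷ ρ) = trans (identityˡ _) (⟦0⟧⇓ ρ)

  ⟦basis⟧⇓ : ∀ {n} (i : Fin n) ρ → ⟦ basis i ⟧⇓ ρ ≈ Data.Vec.lookup ρ i
  ⟦basis⟧⇓ zero    (x ∷ ρ) = trans (∙-cong (identityʳ x) (⟦0⟧⇓ ρ)) (identityʳ x)
  ⟦basis⟧⇓ (suc i) (x ∷ ρ) = trans (identityˡ _) (⟦basis⟧⇓ i ρ)

  ⟦+⟧⇓ : ∀ {n} (u v : Normal n) ρ → ⟦ zipWith ℤ._+_ u v ⟧⇓ ρ ≈ ⟦ u ⟧⇓ ρ ∙ ⟦ v ⟧⇓ ρ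
  ⟦+⟧⇓ []      []      []      = sym (identityˡ ε)
  ⟦+⟧⇓ (i ∷ u) (j ∷ v) (x ∷ ρ) =
    trans (∙-cong (·ℤ-homo-+ i j x) (⟦+⟧⇓ u v ρ)) (interchange _ _ _ _)

  ⟦-⟧⇓ : ∀ {n} (u : Normal n) ρ → ⟦ map ℤ.-_ u ⟧⇓ ρ ≈ ⟦ u ⟧⇓ ρ ⁻¹
  ⟦-⟧⇓ []      []      = sym ε⁻¹≈ε
  ⟦-⟧⇓ (i ∷ u) (x ∷ ρ) = trans (∙-cong (·ℤ-homo-neg i x) (⟦-⟧⇓ u ρ)) (⁻¹-∙-comm _ _)

  correct : ∀ {n} (e : Expr n) ρ → ⟦ normalise e ⟧⇓ ρ ≈ ⟦ e ⟧ ρ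
  correct (var i) ρ = ⟦basis⟧⇓ i ρ
  correct 𝟘       ρ = ⟦0⟧⇓ ρ
  correct (e ⊕ f) ρ = trans (⟦+⟧⇓ (normalise e) (normalise f) ρ) (∙-cong (correct e ρ) (correct f ρ))
  correct (⊝ e)   ρ = trans (⟦-⟧⇓ (normalise e) ρ) (⁻¹-cong (correct e ρ))

  open import Relation.Binary.Reflection setoid var ⟦_⟧ (λ e → ⟦ normalise e ⟧⇓) correct public
    using (solve; _⊜_)


≡-abelianGroup : (G : AbelianGroup 0ℓ 0ℓ) → GroupOnSet G → AbelianGroup 0ℓ 0ℓ
≡-abelianGroup G ≈⇒≡ = record
  { Carrier = Carrier ; _≈_ = _≡_ ; _∙_ = _∙_ ; ε = ε ; _⁻¹ = _⁻¹
  ; isAbelianGroup = record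
    { isGroup = record
      { isMonoid = record
        { isSemigroup = record
          { isMagma = record { isEquivalence = ≡.isEquivalence ; ∙-cong = ≡.cong₂ _∙_ }
          ; assoc = λ x y z → ≈⇒≡ (assoc x y z) }
        ; identity = (λ x → ≈⇒≡ (identityˡ x)) , (λ x → ≈⇒≡ (identityʳ x)) }
      ; inverse = (λ x → ≈⇒≡ (inverseˡ x)) , (λ x → ≈⇒≡ (inverseʳ x))
      ; ⁻¹-cong = ≡.cong _⁻¹ }
    ; comm = λ x y → ≈⇒≡ (comm x y) } }
  where open AbelianGroup G

Additive : (G H : AbelianGroup 0ℓ 0ℓ) → (AbelianGroup.Carrier G → AbelianGroup.Carrier H) → Set
Additive G H f = ∀ x y → f (x G.∙ y) ≡ f x H.∙ f y
  where
  module G = AbelianGroup G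
  module H = AbelianGroup H

module AdditiveMap (G H : AbelianGroup 0ℓ 0ℓ) (≈⇒≡ᴳ : GroupOnSet G) (≈⇒≡ᴴ : GroupOnSet H)
                   {f : AbelianGroup.Carrier G → AbelianGroup.Carrier H} (additive : Additive G H f) where

  private
    module G = AbelianGroup (≡-abelianGroup G ≈⇒≡ᴳ)
    module H where
      open AbelianGroup (≡-abelianGroup H ≈⇒≡ᴴ) public
      open import Algebra.Properties.AbelianGroup (≡-abelianGroup H ≈⇒≡ᴴ) public
        using (identityˡ-unique; inverseʳ-unique)
  open import Algebra.Definitions.RawMonoid G.rawMonoid using () renaming (_×_ to _×ᴳ_)
  open import Algebra.Definitions.RawMonoid H.rawMonoid using () renaming (_×_ to _×ᴴ_)

  ε-homo : f G.ε ≡ H.ε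
  ε-homo = H.identityˡ-unique (f G.ε) (f G.ε)
    (≡.trans (≡.sym (additive G.ε G.ε)) (≡.cong f (G.identityˡ G.ε)))

  ⁻¹-homo : ∀ x → f (x G.⁻¹) ≡ f x H.⁻¹
  ⁻¹-homo x = H.inverseʳ-unique (f x) (f (x G.⁻¹))
    (≡.trans (≡.sym (additive x (x G.⁻¹))) (≡.trans (≡.cong f (G.inverseʳ x)) ε-homo))

  ×-homo : ∀ k x → f (k ×ᴳ x) ≡ k ×ᴴ f x
  ×-homo zero    x = ε-homo
  ×-homo (suc k) x = ≡.trans (additive x (k ×ᴳ x)) (≡.cong (f x H.∙_) (×-homo k x))

-- Finite and cyclic abelian groups

module FiniteAbelianGroup (G : AbelianGroup 0ℓ 0ℓ) (≈⇒≡ : GroupOnSet G)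
                          {n} (e : AbelianGroup.Carrier G ↔ Fin n) where

  private
    G≡ : AbelianGroup 0ℓ 0ℓ
    G≡ = ≡-abelianGroup G ≈⇒≡

  open AbelianGroup G≡
  open import Algebra.Properties.AbelianGroup G≡ using (identityˡ-unique)
  open import Algebra.Definitions.RawMonoid rawMonoid using (_×_)
  open import Algebra.Properties.CommutativeMonoid.Sum commutativeMonoid
    using (sum; sum-cong-≗; sum-permute; ∑-distrib-+; sum-replicate)
  open Inverse e using (to; from; strictlyInverseˡ; strictlyInverseʳ)
  open ≡.≡-Reasoning

  translation : Carrier → Fin n ↔ Fin n
  translation x = mk↔ₛ′ (λ i → to (x ∙ from i)) (λ i → to (x ⁻¹ ∙ from i))
                        (cancel x (x ⁻¹) (inverseʳ x)) (cancel (x ⁻¹) x (inverseˡ x))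
    where
    cancel : ∀ x y → x ∙ y ≡ ε → ∀ i → to (x ∙ from (to (y ∙ from i))) ≡ i
    cancel x y xy≡ε i = begin
      to (x ∙ from (to (y ∙ from i))) ≡⟨ ≡.cong (λ z → to (x ∙ z)) (strictlyInverseʳ _) ⟩
      to (x ∙ (y ∙ from i))           ≡⟨ ≡.cong to (assoc x y (from i)) ⟨
      to (x ∙ y ∙ from i)             ≡⟨ ≡.cong (λ z → to (z ∙ from i)) xy≡ε ⟩
      to (ε ∙ from i)                 ≡⟨ ≡.cong to (identityˡ (from i)) ⟩
      to (from i)                     ≡⟨ strictlyInverseˡ i ⟩
      i                               ∎

  -- Translating by x permutes the elements, so their sum is unchanged: n × x ∙ Σ = Σ.
  ×-order : ∀ x → n × x ≡ ε
  ×-order x = identityˡ-unique (n × x) (sum {n} from) (begin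
    n × x ∙ sum from                        ≡⟨ ≡.cong (_∙ sum from) (sum-replicate n) ⟨
    sum {n} (λ _ → x) ∙ sum from            ≡⟨ ∑-distrib-+ (λ _ → x) from ⟨
    sum {n} (λ i → x ∙ from i)              ≡⟨ sum-cong-≗ (strictlyInverseʳ ∘ (x ∙_) ∘ from) ⟨
    sum {n} (λ i → from (to (x ∙ from i)))  ≡⟨ sum-permute from (translation x) ⟨
    sum from                                ∎)

-- At most m elements are killed by m.
SmallTorsion : AbelianGroup 0ℓ 0ℓ → Set
SmallTorsion G = ∀ m .{{_ : ℕ.NonZero m}} → Σ (Carrier → ℕ) λ code →
  Product._×_ (∀ x → m × x ≈ ε → code x ℕ.< m)
              (∀ x y → m × x ≈ ε → m × y ≈ ε → code x ≡ code y → x ≈ y)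
  where
  open AbelianGroup G
  open import Algebra.Definitions.RawMonoid rawMonoid using (_×_)

module CyclicGroup (G : AbelianGroup 0ℓ 0ℓ) (≈⇒≡ : GroupOnSet G)
                   {r} (e : AbelianGroup.Carrier G ↔ Fin r) (g : AbelianGroup.Carrier G)
                   (generates : ∀ x → Σ ℤ λ k → x ≡ intMul G k g) where

  private
    G≡ : AbelianGroup 0ℓ 0ℓ
    G≡ = ≡-abelianGroup G ≈⇒≡

  open AbelianGroup G≡
  open import Algebra.Properties.AbelianGroup G≡ using (identityˡ-unique; inverseʳ-unique)
  open import Algebra.Definitions.RawMonoid rawMonoid using (_×_)
  open import Algebra.Properties.Monoid.Mult monoid using (×-homo-+; ×-assocˡ)
  open FiniteAbelianGroup G ≈⇒≡ e using (×-order)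
  open Inverse e using (to; from)
  open ≡.≡-Reasoning

  instance
    r-nonZero : ℕ.NonZero r
    r-nonZero = Fin.nonZeroIndex (to ε)

  natMul≡× : ∀ k x → natMul G k x ≡ k × x
  natMul≡× zero    x = ≡.refl
  natMul≡× (suc k) x = ≡.cong (x ∙_) (natMul≡× k x)

  ×-ε : ∀ k → k × ε ≡ ε
  ×-ε zero    = ≡.refl
  ×-ε (suc k) = ≡.trans (identityˡ _) (×-ε k)

  ⁻¹≡pred× : ∀ y → y ⁻¹ ≡ ℕ.pred r × y
  ⁻¹≡pred× y = ≡.sym (inverseʳ-unique y _
    (≡.trans (≡.cong (_× y) (ℕ.suc-pred r)) (×-order y)))

  generates-ℕ : ∀ x → ∃ λ k → x ≡ k × g
  generates-ℕ x with generates x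
  ... | + k      , x≡ = k , ≡.trans x≡ (natMul≡× k g)
  ... | -[1+ k ] , x≡ = ℕ.pred r ℕ.* suc k , (begin
    x                            ≡⟨ x≡ ⟩
    natMul G (suc k) g ⁻¹        ≡⟨ ≡.cong _⁻¹ (natMul≡× (suc k) g) ⟩
    (suc k × g) ⁻¹               ≡⟨ ⁻¹≡pred× (suc k × g) ⟩
    ℕ.pred r × (suc k × g)       ≡⟨ ×-assocˡ g (ℕ.pred r) (suc k) ⟩
    (ℕ.pred r ℕ.* suc k) × g     ∎)

  ×-mod : ∀ d .{{_ : ℕ.NonZero d}} → d × g ≡ ε → ∀ k → k × g ≡ (k % d) × g
  ×-mod d dg≡ε k = begin
    k × g                                ≡⟨ ≡.cong (_× g) (m≡m%n+[m/n]*n k d) ⟩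
    (k % d ℕ.+ k / d ℕ.* d) × g          ≡⟨ ×-homo-+ g (k % d) (k / d ℕ.* d) ⟩
    (k % d) × g ∙ (k / d ℕ.* d) × g      ≡⟨ ≡.cong ((k % d) × g ∙_) (×-assocˡ g (k / d) d) ⟨
    (k % d) × g ∙ (k / d) × (d × g)      ≡⟨ ≡.cong (λ y → (k % d) × g ∙ (k / d) × y) dg≡ε ⟩
    (k % d) × g ∙ (k / d) × ε            ≡⟨ ≡.cong ((k % d) × g ∙_) (×-ε (k / d)) ⟩
    (k % d) × g ∙ ε                      ≡⟨ identityʳ _ ⟩
    (k % d) × g                          ∎

  -- If d × g ≡ ε then every element is one of 0 × g, …, (d − 1) × g, so r ≤ d.
  period-≥-order : ∀ d .{{_ : ℕ.NonZero d}} → d × g ≡ ε → r ℕ.≤ d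
  period-≥-order d dg≡ε = Fin.injective⇒≤ {f = residue} residue-injective
    where
    k : Fin r → ℕ
    k i = proj₁ (generates-ℕ (from i))
    residue : Fin r → Fin d
    residue i = fromℕ< (m%n<n (k i) d)
    from≡ : ∀ i → from i ≡ toℕ (residue i) × g
    from≡ i = ≡.trans (proj₂ (generates-ℕ (from i))) (≡.trans (×-mod d dg≡ε (k i))
                (≡.cong (_× g) (≡.sym (Fin.toℕ-fromℕ< (m%n<n (k i) d)))))
    residue-injective : ∀ {i j} → residue i ≡ residue j → i ≡ j
    residue-injective {i} {j} eq = Injection.injective (↔⇒↣ (↔-sym e))
      (≡.trans (from≡ i) (≡.trans (≡.cong (λ t → toℕ t × g) eq) (≡.sym (from≡ j))))

  no-smaller-period : ∀ {i j} → i ℕ.< j → j ℕ.< r → i × g ≡ j × g → ⊥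
  no-smaller-period {i} {j} i<j j<r ig≡jg =
    ℕ.<⇒≱ (ℕ.≤-<-trans (ℕ.m∸n≤m j i) j<r)
          (period-≥-order (j ℕ.∸ i) {{ℕ.>-nonZero (ℕ.m<n⇒0<n∸m i<j)}} [j-i]g≡ε)
    where
    [j-i]g≡ε : (j ℕ.∸ i) × g ≡ ε
    [j-i]g≡ε = identityˡ-unique _ (i × g) (begin
      (j ℕ.∸ i) × g ∙ i × g  ≡⟨ ×-homo-+ g (j ℕ.∸ i) i ⟨
      (j ℕ.∸ i ℕ.+ i) × g    ≡⟨ ≡.cong (_× g) (ℕ.m∸n+n≡m (ℕ.<⇒≤ i<j)) ⟩
      j × g                  ≡⟨ ig≡jg ⟨
      i × g                  ∎)

  ×g-injective : ∀ {i j} → i ℕ.< r → j ℕ.< r → i × g ≡ j × g → i ≡ j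
  ×g-injective {i} {j} i<r j<r eq with ℕ.<-cmp i j
  ... | tri< i<j _ _ = ⊥-elim (no-smaller-period i<j j<r eq)
  ... | tri≈ _ i≡j _ = i≡j
  ... | tri> _ _ j<i = ⊥-elim (no-smaller-period j<i i<r (≡.sym eq))

  index : Carrier → ℕ
  index x = proj₁ (generates-ℕ x) % r

  index<r : ∀ x → index x ℕ.< r
  index<r x = m%n<n _ r

  index-correct : ∀ x → index x × g ≡ x
  index-correct x = ≡.sym (≡.trans (proj₂ (generates-ℕ x)) (×-mod r (×-order g) _))

  -- m × x ≡ ε with x = i × g means r ∣ m * i; the code of x is the quotient m * i / r.
  smallTorsion : SmallTorsion G≡
  smallTorsion m = code , code<m , code-injective
    where
    code : Carrier → ℕ
    code x = m ℕ.* index x / r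
    divides : ∀ x → m × x ≡ ε → m ℕ.* index x ≡ code x ℕ.* r
    divides x mx≡ε = ≡.trans (m≡m%n+[m/n]*n (m ℕ.* index x) r)
                             (≡.cong (ℕ._+ code x ℕ.* r) remainder≡0)
      where
      remainder≡0 : m ℕ.* index x % r ≡ 0
      remainder≡0 = ×g-injective (m%n<n _ r) (ℕ.>-nonZero⁻¹ r) (begin
        (m ℕ.* index x % r) × g   ≡⟨ ×-mod r (×-order g) _ ⟨
        (m ℕ.* index x) × g       ≡⟨ ×-assocˡ g m (index x) ⟨
        m × (index x × g)         ≡⟨ ≡.cong (m ×_) (index-correct x) ⟩
        m × x                     ≡⟨ mx≡ε ⟩
        ε                         ∎)
    code<m : ∀ x → m × x ≡ ε → code x ℕ.< m
    code<m x _ = m<n*o⇒m/o<n (ℕ.*-monoʳ-< m (index<r x))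
    code-injective : ∀ x y → m × x ≡ ε → m × y ≡ ε → code x ≡ code y → x ≡ y
    code-injective x y mx≡ε my≡ε eq = begin
      x              ≡⟨ index-correct x ⟨
      index x × g    ≡⟨ ≡.cong (_× g) (ℕ.*-cancelˡ-≡ (index x) (index y) m m[ix]≡m[iy]) ⟩
      index y × g    ≡⟨ index-correct y ⟩
      y              ∎
      where
      m[ix]≡m[iy] : m ℕ.* index x ≡ m ℕ.* index y
      m[ix]≡m[iy] = ≡.trans (divides x mx≡ε)
                      (≡.trans (≡.cong (ℕ._* r) eq) (≡.sym (divides y my≡ε)))

⌊1+n/2⌋+⌊1+n/2⌋≡1+n : ∀ n → Odd n → ⌊ suc n /2⌋ ℕ.+ ⌊ suc n /2⌋ ≡ suc n
⌊1+n/2⌋+⌊1+n/2⌋≡1+n zero          ()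
⌊1+n/2⌋+⌊1+n/2⌋≡1+n (suc zero)    _   = ≡.refl
⌊1+n/2⌋+⌊1+n/2⌋≡1+n (suc (suc n)) odd =
  ≡.cong suc (≡.trans (ℕ.+-suc _ _) (≡.cong suc (⌊1+n/2⌋+⌊1+n/2⌋≡1+n n odd)))

-- Counting characters of finite abelian groups

module Fibres {Y : Set} (code : Y → ℕ) where

  fibre : ℕ → List Y → List Y
  fibre j = filter (λ y → code y ℕ.≟ j)

  fibreSizes : ℕ → List Y → ℕ
  fibreSizes zero    L = 0
  fibreSizes (suc m) L = length (fibre m L) ℕ.+ fibreSizes m L

  fibreSizes-[] : ∀ m → fibreSizes m [] ≡ 0
  fibreSizes-[] zero    = ≡.refl
  fibreSizes-[] (suc m) = fibreSizes-[] m

  fibreSizes-∷-≥ : ∀ m y L → m ℕ.≤ code y → fibreSizes m (y ∷ L) ≡ fibreSizes m L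
  fibreSizes-∷-≥ zero    y L _      = ≡.refl
  fibreSizes-∷-≥ (suc m) y L m<code = ≡.cong₂ ℕ._+_
    (≡.cong length (List.filter-reject (λ y → code y ℕ.≟ m) (ℕ.>⇒≢ m<code)))
    (fibreSizes-∷-≥ m y L (ℕ.<⇒≤ m<code))

  fibreSizes-∷-< : ∀ m y L → code y ℕ.< m → fibreSizes m (y ∷ L) ≡ suc (fibreSizes m L)
  fibreSizes-∷-< (suc m) y L code<1+m with code y ℕ.≟ m
  ... | yes code≡m = ≡.cong₂ ℕ._+_
    (≡.cong length (List.filter-accept (λ y → code y ℕ.≟ m) code≡m))
    (fibreSizes-∷-≥ m y L (ℕ.≤-reflexive (≡.sym code≡m)))
  ... | no  code≢m = ≡.trans (≡.cong₂ ℕ._+_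
    (≡.cong length (List.filter-reject (λ y → code y ℕ.≟ m) code≢m))
    (fibreSizes-∷-< m y L (ℕ.≤∧≢⇒< (ℕ.≤-pred code<1+m) code≢m))) (ℕ.+-suc _ _)

  length≡fibreSizes : ∀ m L → All (λ y → code y ℕ.< m) L → length L ≡ fibreSizes m L
  length≡fibreSizes m []      []           = ≡.sym (fibreSizes-[] m)
  length≡fibreSizes m (y ∷ L) (y<m ∷ L<m) =
    ≡.trans (≡.cong suc (length≡fibreSizes m L L<m)) (≡.sym (fibreSizes-∷-< m y L y<m))

  fibreSizes-bound : ∀ m L w n → (∀ j → j ℕ.< m → length (fibre j L) ℕ.* w ℕ.≤ n) →
                     fibreSizes m L ℕ.* w ℕ.≤ m ℕ.* n
  fibreSizes-bound zero    L w n _     = ℕ.z≤n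
  fibreSizes-bound (suc m) L w n bound = begin
    (length (fibre m L) ℕ.+ fibreSizes m L) ℕ.* w
      ≡⟨ ℕ.*-distribʳ-+ w (length (fibre m L)) (fibreSizes m L) ⟩
    length (fibre m L) ℕ.* w ℕ.+ fibreSizes m L ℕ.* w
      ≤⟨ ℕ.+-mono-≤ (bound m ℕ.≤-refl) (fibreSizes-bound m L w n (λ j → bound j ∘ ℕ.m≤n⇒m≤1+n)) ⟩
    n ℕ.+ m ℕ.* n
      ∎
    where open ℕ.≤-Reasoning

  length-≤-fibres : ∀ m L w n → All (λ y → code y ℕ.< m) L →
                    (∀ j → j ℕ.< m → length (fibre j L) ℕ.* w ℕ.≤ n) →
                    length L ℕ.* w ℕ.≤ m ℕ.* n
  length-≤-fibres m L w n L<m bound = ℕ.≤-trans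
    (ℕ.≤-reflexive (≡.cong (ℕ._* w) (length≡fibreSizes m L L<m))) (fibreSizes-bound m L w n bound)

module CharacterBound (X : AbelianGroup 0ℓ 0ℓ) (≈⇒≡ˣ : GroupOnSet X)
                      {n} (e : AbelianGroup.Carrier X ↔ Fin n)
                      (C : AbelianGroup 0ℓ 0ℓ) (≈⇒≡ᶜ : GroupOnSet C)
                      (small : SmallTorsion (≡-abelianGroup C ≈⇒≡ᶜ)) where

  private
    X≡ C≡ : AbelianGroup 0ℓ 0ℓ
    X≡ = ≡-abelianGroup X ≈⇒≡ˣ
    C≡ = ≡-abelianGroup C ≈⇒≡ᶜ
    module X where
      open AbelianGroup X≡ public
      open import Algebra.Properties.AbelianGroup X≡ public using (⁻¹-involutive; x≈z//y; ∙-cancelʳ)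
      open import Algebra.Definitions.RawMonoid rawMonoid public using (_×_)
      open import Algebra.Properties.Monoid.Mult monoid public using (×-homo-+; ×-assocˡ)
      open AbelianGroupSolver X≡ public using (solve; _⊜_; _⊕_; ⊝_; 𝟘)
    module C where
      open AbelianGroup C≡ public
      open import Algebra.Properties.AbelianGroup C≡ public using (∙-cancelʳ)
      open import Algebra.Definitions.RawMonoid rawMonoid public using (_×_)
      open AbelianGroupSolver C≡ public using (solve; _⊜_; _⊕_; ⊝_)
  open FiniteAbelianGroup X ≈⇒≡ˣ e using (×-order)
  open Inverse e using (to; from; strictlyInverseʳ)

  instance
    n-nonZero : ℕ.NonZero n
    n-nonZero = Fin.nonZeroIndex (to X.ε)

  Character : Set
  Character = X.Carrier → C.Carrier

  Distinct : Character → Character → Set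
  Distinct f g = ¬ (f ≗ g)

  record Subgroup≥ (s : ℕ) : Set₁ where
    field
      Member            : X.Carrier → Set
      member?           : Decidable Member
      ε-member          : Member X.ε
      ∙⁻¹-member        : ∀ {y z} → Member y → Member z → Member (y X.∙ z X.⁻¹)
      element           : Fin s → X.Carrier
      element-injective : ∀ {i j} → element i ≡ element j → i ≡ j
      element-member    : ∀ i → Member (element i)

    ⁻¹-member : ∀ {y} → Member y → Member (y X.⁻¹)
    ⁻¹-member y∈ = ≡.subst Member (X.identityˡ _) (∙⁻¹-member ε-member y∈)

    ∙-member : ∀ {y z} → Member y → Member z → Member (y X.∙ z)
    ∙-member {y} {z} y∈ z∈ =
      ≡.subst Member (≡.cong (y X.∙_) (X.⁻¹-involutive z)) (∙⁻¹-member y∈ (⁻¹-member z∈))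

    ×-member : ∀ k {y} → Member y → Member (k X.× y)
    ×-member zero    y∈ = ε-member
    ×-member (suc k) y∈ = ∙-member y∈ (×-member k y∈)

    size≤n : s ℕ.≤ n
    size≤n = Fin.injective⇒≤ (λ eq → element-injective (Injection.injective (↔⇒↣ e) eq))

  VanishesOn : ∀ {s} → Subgroup≥ s → Character → Set
  VanishesOn S f = ∀ {y} → Subgroup≥.Member S y → f y ≡ C.ε

  CharacterVanishingOn : ∀ {s} → Subgroup≥ s → Character → Set
  CharacterVanishingOn S f = Product._×_ (Additive X C f) (VanishesOn S f)

  difference : Character → Character → Character
  difference f g y = f y C.∙ g y C.⁻¹

  difference-distinct : ∀ {f g} h → Distinct f g → Distinct (difference f h) (difference g h)
  difference-distinct h f≢g f-h≡g-h = f≢g (λ y → C.∙-cancelʳ (h y C.⁻¹) _ _ (f-h≡g-h y))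

  difference-additive : ∀ {f g} → Additive X C f → Additive X C g → Additive X C (difference f g)
  difference-additive {f} {g} f+ g+ y z = begin
    f (y X.∙ z) C.∙ g (y X.∙ z) C.⁻¹
      ≡⟨ ≡.cong₂ (λ a b → a C.∙ b C.⁻¹) (f+ y z) (g+ y z) ⟩
    (f y C.∙ f z) C.∙ (g y C.∙ g z) C.⁻¹
      ≡⟨ C.solve 4 (λ a b c d → (a ⊕ b) ⊕ ⊝ (c ⊕ d) ⊜ (a ⊕ ⊝ c) ⊕ (b ⊕ ⊝ d)) ≡.refl (f y) (f z) (g y) (g z) ⟩
    (f y C.∙ g y C.⁻¹) C.∙ (f z C.∙ g z C.⁻¹)
      ∎
    where
    open C using (_⊕_; ⊝_; _⊜_)
    open ≡.≡-Reasoning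

  value-on-coset : ∀ {s} {S : Subgroup≥ s} {f} → CharacterVanishingOn S f →
                   ∀ {x y} k → Subgroup≥.Member S (y X.∙ (k X.× x) X.⁻¹) → f y ≡ k C.× f x
  value-on-coset {f = f} (f+ , f|S) {x} {y} k y-kx∈ = begin
    f y
      ≡⟨ ≡.cong f (X.solve 2 (λ y z → y ⊜ y ⊕ ⊝ z ⊕ z) ≡.refl y (k X.× x)) ⟩
    f (y X.∙ (k X.× x) X.⁻¹ X.∙ k X.× x)
      ≡⟨ f+ _ _ ⟩
    f (y X.∙ (k X.× x) X.⁻¹) C.∙ f (k X.× x)
      ≡⟨ ≡.cong₂ C._∙_ (f|S y-kx∈) (AdditiveMap.×-homo X C ≈⇒≡ˣ ≈⇒≡ᶜ f+ k x) ⟩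
    C.ε C.∙ k C.× f x
      ≡⟨ C.identityˡ _ ⟩
    k C.× f x ∎
    where
    open X using (_⊕_; ⊝_; _⊜_)
    open ≡.≡-Reasoning

  module Extension {s} (S : Subgroup≥ s) (x : X.Carrier) where

    open Subgroup≥ S
    open X using (_⊕_; ⊝_; _⊜_; 𝟘)
    open ≡.≡-Reasoning

    private
      Unreached : Fin n → Set
      Unreached i = ¬ Member (suc (toℕ i) X.× x)

      pred[n]<n : ℕ.pred n ℕ.< n
      pred[n]<n = ℕ.m≤pred[n]⇒suc[m]≤n ℕ.≤-refl

      last : Fin n
      last = fromℕ< pred[n]<n

      reached : ¬ (∀ i → Unreached i)
      reached unreached = unreached last (≡.subst Member (begin
        X.ε                        ≡⟨ ×-order x ⟨
        n X.× x                    ≡⟨ ≡.cong (X._× x) (ℕ.suc-pred n) ⟨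
        suc (ℕ.pred n) X.× x       ≡⟨ ≡.cong (λ k → suc k X.× x) (Fin.toℕ-fromℕ< pred[n]<n) ⟨
        suc (toℕ last) X.× x       ∎) ε-member)

      smallest : Σ (Fin n) λ i → Product._×_ (¬ Unreached i) (∀ (j : Fin (toℕ i)) → Unreached (inject j))
      smallest = Fin.¬∀⟶∃¬-smallest n Unreached (λ i → ¬? (member? _)) reached

    -- The order of x modulo S.
    m : ℕ
    m = suc (toℕ (proj₁ smallest))

    mx-member : Member (m X.× x)
    mx-member = decidable-stable (member? _) (proj₁ (proj₂ smallest))

    minimal : ∀ {k} → k ℕ.< m → Member (k X.× x) → k ≡ 0
    minimal {zero}  _           _  = ≡.refl
    minimal {suc k} (ℕ.s≤s k<i) k∈ = ⊥-elim (proj₂ (proj₂ smallest) (fromℕ< k<i)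
      (≡.subst (λ t → Member (suc t X.× x))
               (≡.sym (≡.trans (Fin.toℕ-inject (fromℕ< k<i)) (Fin.toℕ-fromℕ< k<i))) k∈))

    private
      multiples-distinct-≥ : ∀ {i j} → j ℕ.≤ i → i ℕ.< m → Member (i X.× x X.∙ (j X.× x) X.⁻¹) → i ≡ j
      multiples-distinct-≥ {i} {j} j≤i i<m ij∈ =
        ℕ.≤-antisym (ℕ.m∸n≡0⇒m≤n (minimal (ℕ.≤-<-trans (ℕ.m∸n≤m i j) i<m) (≡.subst Member i-j ij∈))) j≤i
        where
        i-j : i X.× x X.∙ (j X.× x) X.⁻¹ ≡ (i ℕ.∸ j) X.× x
        i-j = ≡.sym (X.x≈z//y _ _ _
          (≡.trans (≡.sym (X.×-homo-+ x (i ℕ.∸ j) j)) (≡.cong (X._× x) (ℕ.m∸n+n≡m j≤i))))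

    multiples-distinct : ∀ {i j} → i ℕ.< m → j ℕ.< m → Member (i X.× x X.∙ (j X.× x) X.⁻¹) → i ≡ j
    multiples-distinct {i} {j} i<m j<m ij∈ with ℕ.≤-total j i
    ... | inj₁ j≤i = multiples-distinct-≥ j≤i i<m ij∈
    ... | inj₂ i≤j = ≡.sym (multiples-distinct-≥ i≤j j<m (≡.subst Member
      (X.solve 2 (λ a b → ⊝ (a ⊕ ⊝ b) ⊜ b ⊕ ⊝ a) ≡.refl (i X.× x) (j X.× x)) (⁻¹-member ij∈)))

    Member′ : X.Carrier → Set
    Member′ y = Σ (Fin m) λ j → Member (y X.∙ (toℕ j X.× x) X.⁻¹)

    member′ : ∀ k {y} → Member (y X.∙ (k X.× x) X.⁻¹) → Member′ y
    member′ k {y} y-kx∈ =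
      fromℕ< (m%n<n k m) , ≡.subst Member y-rx≡ (∙-member y-kx∈ (×-member (k / m) mx-member))
      where
      q r : X.Carrier
      q = (k / m) X.× (m X.× x)
      r = (k % m) X.× x
      kx≡ : k X.× x ≡ r X.∙ q
      kx≡ = begin
        k X.× x                         ≡⟨ ≡.cong (X._× x) (m≡m%n+[m/n]*n k m) ⟩
        (k % m ℕ.+ k / m ℕ.* m) X.× x   ≡⟨ X.×-homo-+ x (k % m) _ ⟩
        r X.∙ (k / m ℕ.* m) X.× x       ≡⟨ ≡.cong (r X.∙_) (X.×-assocˡ x (k / m) m) ⟨
        r X.∙ q                         ∎
      y-rx≡ : y X.∙ (k X.× x) X.⁻¹ X.∙ q ≡ y X.∙ (toℕ (fromℕ< (m%n<n k m)) X.× x) X.⁻¹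
      y-rx≡ = begin
        y X.∙ (k X.× x) X.⁻¹ X.∙ q    ≡⟨ ≡.cong (λ t → y X.∙ t X.⁻¹ X.∙ q) kx≡ ⟩
        y X.∙ (r X.∙ q) X.⁻¹ X.∙ q    ≡⟨ X.solve 3 (λ y r q → y ⊕ ⊝ (r ⊕ q) ⊕ q ⊜ y ⊕ ⊝ r) ≡.refl y r q ⟩
        y X.∙ r X.⁻¹                  ≡⟨ ≡.cong (λ t → y X.∙ (t X.× x) X.⁻¹) (Fin.toℕ-fromℕ< (m%n<n k m)) ⟨
        y X.∙ (toℕ (fromℕ< (m%n<n k m)) X.× x) X.⁻¹ ∎

    -- (y − i x) − (y′ − j x) − m x = (y − y′) − (i + (m − j)) x
    ∙⁻¹-member′ : ∀ {y y′} → Member′ y → Member′ y′ → Member′ (y X.∙ y′ X.⁻¹)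
    ∙⁻¹-member′ {y} {y′} (i , y-ix∈) (j , y′-jx∈) =
      member′ (toℕ i ℕ.+ (m ℕ.∸ toℕ j))
              (≡.subst Member shift (∙⁻¹-member (∙⁻¹-member y-ix∈ y′-jx∈) mx-member))
      where
      I J K : X.Carrier
      I = toℕ i X.× x
      J = toℕ j X.× x
      K = (m ℕ.∸ toℕ j) X.× x
      mx≡ : m X.× x ≡ J X.∙ K
      mx≡ = ≡.trans (≡.cong (X._× x) (≡.sym (ℕ.m+[n∸m]≡n (ℕ.<⇒≤ (Fin.toℕ<n j))))) (X.×-homo-+ x (toℕ j) _)
      shift : (y X.∙ I X.⁻¹) X.∙ (y′ X.∙ J X.⁻¹) X.⁻¹ X.∙ (m X.× x) X.⁻¹
            ≡ (y X.∙ y′ X.⁻¹) X.∙ ((toℕ i ℕ.+ (m ℕ.∸ toℕ j)) X.× x) X.⁻¹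
      shift = begin
        (y X.∙ I X.⁻¹) X.∙ (y′ X.∙ J X.⁻¹) X.⁻¹ X.∙ (m X.× x) X.⁻¹
          ≡⟨ ≡.cong (λ t → (y X.∙ I X.⁻¹) X.∙ (y′ X.∙ J X.⁻¹) X.⁻¹ X.∙ t X.⁻¹) mx≡ ⟩
        (y X.∙ I X.⁻¹) X.∙ (y′ X.∙ J X.⁻¹) X.⁻¹ X.∙ (J X.∙ K) X.⁻¹
          ≡⟨ X.solve 5 (λ y y′ I J K → (y ⊕ ⊝ I) ⊕ ⊝ (y′ ⊕ ⊝ J) ⊕ ⊝ (J ⊕ K) ⊜ (y ⊕ ⊝ y′) ⊕ ⊝ (I ⊕ K))
                       ≡.refl y y′ I J K ⟩
        (y X.∙ y′ X.⁻¹) X.∙ (I X.∙ K) X.⁻¹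
          ≡⟨ ≡.cong (λ t → (y X.∙ y′ X.⁻¹) X.∙ t X.⁻¹) (X.×-homo-+ x (toℕ i) _) ⟨
        (y X.∙ y′ X.⁻¹) X.∙ ((toℕ i ℕ.+ (m ℕ.∸ toℕ j)) X.× x) X.⁻¹ ∎

    private
      split : Fin (m ℕ.* s) ↔ Product._×_ (Fin m) (Fin s)
      split = Fin.*↔× {m} {s}

    element′ : Fin (m ℕ.* s) → X.Carrier
    element′ k = element (proj₂ (Inverse.to split k)) X.∙ toℕ (proj₁ (Inverse.to split k)) X.× x

    element′-member : ∀ k → Member′ (element′ k)
    element′-member k = j , ≡.subst Member
      (X.solve 2 (λ a b → a ⊜ a ⊕ b ⊕ ⊝ b) ≡.refl (element t) (toℕ j X.× x)) (element-member t)
      where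
      j : Fin m
      j = proj₁ (Inverse.to split k)
      t : Fin s
      t = proj₂ (Inverse.to split k)

    element′-injective : ∀ {k k′} → element′ k ≡ element′ k′ → k ≡ k′
    element′-injective {k} {k′} eq = Injection.injective (↔⇒↣ split) (×-≡,≡→≡ (j≡j′ , t≡t′))
      where
      j j′ : Fin m
      j  = proj₁ (Inverse.to split k)
      j′ = proj₁ (Inverse.to split k′)
      t t′ : Fin s
      t  = proj₂ (Inverse.to split k)
      t′ = proj₂ (Inverse.to split k′)
      jx-j′x∈ : Member (toℕ j X.× x X.∙ (toℕ j′ X.× x) X.⁻¹)
      jx-j′x∈ = ≡.subst Member (begin
        element t′ X.∙ element t X.⁻¹
          ≡⟨ X.solve 4 (λ a b c d → b ⊕ ⊝ a ⊜ (b ⊕ d) ⊕ ⊝ (a ⊕ c) ⊕ (c ⊕ ⊝ d)) ≡.refl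
                       (element t) (element t′) (toℕ j X.× x) (toℕ j′ X.× x) ⟩
        element′ k′ X.∙ element′ k X.⁻¹ X.∙ (toℕ j X.× x X.∙ (toℕ j′ X.× x) X.⁻¹)
          ≡⟨ ≡.cong (λ z → z X.∙ element′ k X.⁻¹ X.∙ (toℕ j X.× x X.∙ (toℕ j′ X.× x) X.⁻¹)) eq ⟨
        element′ k X.∙ element′ k X.⁻¹ X.∙ (toℕ j X.× x X.∙ (toℕ j′ X.× x) X.⁻¹)
          ≡⟨ X.solve 2 (λ a b → a ⊕ ⊝ a ⊕ b ⊜ b) ≡.refl (element′ k) _ ⟩
        toℕ j X.× x X.∙ (toℕ j′ X.× x) X.⁻¹ ∎) (∙⁻¹-member (element-member t′) (element-member t))
      j≡j′ : j ≡ j′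
      j≡j′ = Fin.toℕ-injective (multiples-distinct (Fin.toℕ<n j) (Fin.toℕ<n j′) jx-j′x∈)
      t≡t′ : t ≡ t′
      t≡t′ = element-injective
        (X.∙-cancelʳ _ _ _ (≡.trans eq (≡.cong (λ i → element t′ X.∙ toℕ i X.× x) (≡.sym j≡j′))))

    extension : Subgroup≥ (m ℕ.* s)
    extension = record
      { Member            = Member′
      ; member?           = λ y → Fin.any? (λ j → member? _)
      ; ε-member          = zero , ≡.subst Member (≡.sym (X.inverseʳ X.ε)) ε-member
      ; ∙⁻¹-member        = ∙⁻¹-member′
      ; element           = element′
      ; element-injective = element′-injective
      ; element-member    = element′-member
      }

    member⇒member′ : ∀ {y} → Member y → Member′ y
    member⇒member′ {y} y∈ = member′ 0 (≡.subst Member (≡.sym (X.solve 1 (λ y → y ⊕ ⊝ 𝟘 ⊜ y) ≡.refl y)) y∈)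

    x-member′ : Member′ x
    x-member′ = member′ 1 (≡.subst Member (≡.sym (X.solve 1 (λ x → x ⊕ ⊝ (x ⊕ 𝟘) ⊜ 𝟘) ≡.refl x)) ε-member)

    torsion : ∀ {f} → CharacterVanishingOn S f → m C.× f x ≡ C.ε
    torsion (f+ , f|S) = ≡.trans (≡.sym (AdditiveMap.×-homo X C ≈⇒≡ˣ ≈⇒≡ᶜ f+ m x)) (f|S mx-member)

    difference-good : ∀ {f f₀} → CharacterVanishingOn S f → CharacterVanishingOn S f₀ → f x ≡ f₀ x →
                      CharacterVanishingOn extension (difference f f₀)
    difference-good {f} {f₀} f-good f₀-good fx≡f₀x =
      difference-additive (proj₁ f-good) (proj₁ f₀-good) , vanishes
      where
      vanishes : VanishesOn extension (difference f f₀)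
      vanishes {y} (j , y-jx∈) = begin
        f y C.∙ f₀ y C.⁻¹                        ≡⟨ ≡.cong₂ (λ a b → a C.∙ b C.⁻¹)
                                                      (value-on-coset {S = S} f-good (toℕ j) y-jx∈)
                                                      (value-on-coset {S = S} f₀-good (toℕ j) y-jx∈) ⟩
        toℕ j C.× f x C.∙ (toℕ j C.× f₀ x) C.⁻¹  ≡⟨ ≡.cong (λ c → toℕ j C.× c C.∙ (toℕ j C.× f₀ x) C.⁻¹) fx≡f₀x ⟩
        toℕ j C.× f₀ x C.∙ (toℕ j C.× f₀ x) C.⁻¹ ≡⟨ C.inverseʳ _ ⟩
        C.ε                                      ∎

  at-most-one-zero : ∀ L → All (λ f → ∀ y → f y ≡ C.ε) L → AllPairs Distinct L → length L ℕ.≤ 1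
  at-most-one-zero []          _               _                 = ℕ.z≤n
  at-most-one-zero (_ ∷ [])    _               _                 = ℕ.s≤s ℕ.z≤n
  at-most-one-zero (f ∷ g ∷ _) (f≡ε ∷ g≡ε ∷ _) ((f≢g ∷ _) ∷ _) =
    ⊥-elim (f≢g (λ y → ≡.trans (f≡ε y) (≡.sym (g≡ε y))))

  -- Adjoining x multiplies the size of S by the
  -- order m of x modulo S, while the characters fall into at most m classes by their value at x; subtracting
  -- one member of a class turns it into distinct characters vanishing on the larger subgroup.
  bound : ∀ {s} (S : Subgroup≥ s) (xs : List X.Carrier) → (∀ y → Subgroup≥.Member S y ⊎ y ∈ xs) →
          ∀ L → All (CharacterVanishingOn S) L → AllPairs Distinct L → length L ℕ.* s ℕ.≤ n
  bound {s} S [] covered L good distinct = begin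
    length L ℕ.* s
      ≤⟨ ℕ.*-monoˡ-≤ s (at-most-one-zero L (All.map (λ (_ , f|S) y → f|S (member y)) good) distinct) ⟩
    1 ℕ.* s
      ≡⟨ ℕ.*-identityˡ s ⟩
    s
      ≤⟨ Subgroup≥.size≤n S ⟩
    n ∎
    where
    open ℕ.≤-Reasoning
    member : ∀ y → Subgroup≥.Member S y
    member y with covered y
    ... | inj₁ y∈S = y∈S
    ... | inj₂ ()
  bound {s} S (x ∷ xs) covered L good distinct = ℕ.*-cancelˡ-≤ m (begin
    m ℕ.* (length L ℕ.* s)    ≡⟨ ℕ.*-assoc m (length L) s ⟨
    m ℕ.* length L ℕ.* s      ≡⟨ ≡.cong (ℕ._* s) (ℕ.*-comm m (length L)) ⟩
    length L ℕ.* m ℕ.* s      ≡⟨ ℕ.*-assoc (length L) m s ⟩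
    length L ℕ.* (m ℕ.* s)    ≤⟨ length-≤-fibres m L (m ℕ.* s) n (All.map code<m good) fibre-bound ⟩
    m ℕ.* n                   ∎)
    where
    open ℕ.≤-Reasoning
    open Extension S x
    code : C.Carrier → ℕ
    code = proj₁ (small m)
    code-injective : ∀ c c′ → m C.× c ≡ C.ε → m C.× c′ ≡ C.ε → code c ≡ code c′ → c ≡ c′
    code-injective = proj₂ (proj₂ (small m))
    open Fibres {Y = Character} (λ f → code (f x))

    code<m : ∀ {f} → CharacterVanishingOn S f → code (f x) ℕ.< m
    code<m f-good = proj₁ (proj₂ (small m)) _ (torsion f-good)

    covered′ : ∀ y → Member′ y ⊎ y ∈ xs
    covered′ y with covered y
    ... | inj₁ y∈S          = inj₁ (member⇒member′ y∈S)
    ... | inj₂ (here ≡.refl) = inj₁ x-member′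
    ... | inj₂ (there y∈xs) = inj₂ y∈xs

    same-value-bound : ∀ {j} F → All (λ f → code (f x) ≡ j) F → All (CharacterVanishingOn S) F →
                       AllPairs Distinct F → length F ℕ.* (m ℕ.* s) ℕ.≤ n
    same-value-bound      []       _            _                  _        = ℕ.z≤n
    same-value-bound {j} (f₀ ∷ F) (f₀≡j ∷ F≡j) (f₀-good ∷ F-good) distinct =
      ≡.subst (λ l → l ℕ.* (m ℕ.* s) ℕ.≤ n) (List.length-map (λ f → difference f f₀) (f₀ ∷ F))
        (bound extension xs covered′ (List.map (λ f → difference f f₀) (f₀ ∷ F))
           (All.map⁺ (All.zipWith (λ (f≡j , f-good) → difference-good f-good f₀-good (same-value f-good f≡j))
                                  (f₀≡j ∷ F≡j , f₀-good ∷ F-good)))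
           (AllPairs.map⁺ (AllPairs.map (difference-distinct f₀) distinct)))
      where
      same-value : ∀ {f} → CharacterVanishingOn S f → code (f x) ≡ j → f x ≡ f₀ x
      same-value f-good f≡j = code-injective _ _ (torsion f-good) (torsion f₀-good) (≡.trans f≡j (≡.sym f₀≡j))

    fibre-bound : ∀ j → j ℕ.< m → length (fibre j L) ℕ.* (m ℕ.* s) ℕ.≤ n
    fibre-bound j _ =
      same-value-bound (fibre j L) (All.all-filter _ L) (All.filter⁺ _ good) (AllPairs.filter⁺ _ distinct)

  trivial : Subgroup≥ 1
  trivial = record
    { Member            = _≡ X.ε
    ; member?           = λ y → via-injection (↔⇒↣ e) Fin._≟_ y X.ε
    ; ε-member          = ≡.refl
    ; ∙⁻¹-member        = λ { ≡.refl ≡.refl → X.inverseʳ X.ε }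
    ; element           = λ _ → X.ε
    ; element-injective = λ { {zero} {zero} _ → ≡.refl }
    ; element-member    = λ _ → ≡.refl
    }

  characterBound : ∀ L → All (Additive X C) L → AllPairs Distinct L → length L ℕ.≤ n
  characterBound L additive distinct = ≡.subst (ℕ._≤ n) (ℕ.*-identityʳ (length L))
    (bound trivial (tabulate from) covered L (All.map good additive) distinct)
    where
    good : ∀ {f} → Additive X C f → CharacterVanishingOn trivial f
    good f+ = f+ , λ { ≡.refl → AdditiveMap.ε-homo X C ≈⇒≡ˣ ≈⇒≡ᶜ f+ }
    covered : ∀ y → y ≡ X.ε ⊎ y ∈ tabulate from
    covered y = inj₂ (≡.subst (_∈ tabulate from) (strictlyInverseʳ y) (∈-tabulate⁺ (to y)))

module PairingDuality (A B C : AbelianGroup 0ℓ 0ℓ)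
                      (≈⇒≡ᴬ : GroupOnSet A) (≈⇒≡ᴮ : GroupOnSet B) (≈⇒≡ᶜ : GroupOnSet C)
                      {nA nB} (eA : AbelianGroup.Carrier A ↔ Fin nA) (eB : AbelianGroup.Carrier B ↔ Fin nB)
                      (small : SmallTorsion (≡-abelianGroup C ≈⇒≡ᶜ))
                      (_≟_ : DecidableEquality (AbelianGroup.Carrier C))
                      (pair : AbelianGroup.Carrier A → AbelianGroup.Carrier B → AbelianGroup.Carrier C)
                      (additiveˡ : ∀ b → Additive A C (λ a → pair a b))
                      (additiveʳ : ∀ a → Additive B C (pair a))
                      (nondegenerateˡ : ∀ a → (∀ b → pair a b ≡ AbelianGroup.ε C) → a ≡ AbelianGroup.ε A)
                      (nondegenerateʳ : ∀ b → (∀ a → pair a b ≡ AbelianGroup.ε C) → b ≡ AbelianGroup.ε B) where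

  private
    module A where
      open AbelianGroup (≡-abelianGroup A ≈⇒≡ᴬ) public
      open import Algebra.Properties.AbelianGroup (≡-abelianGroup A ≈⇒≡ᴬ) public using (x∙y⁻¹≈ε⇒x≈y)
    module B where
      open AbelianGroup (≡-abelianGroup B ≈⇒≡ᴮ) public
      open import Algebra.Properties.AbelianGroup (≡-abelianGroup B ≈⇒≡ᴮ) public using (x∙y⁻¹≈ε⇒x≈y)
    module C = AbelianGroup (≡-abelianGroup C ≈⇒≡ᶜ)
    module CharactersOfA = CharacterBound A ≈⇒≡ᴬ eA C ≈⇒≡ᶜ small
    module CharactersOfB = CharacterBound B ≈⇒≡ᴮ eB C ≈⇒≡ᶜ small
    module eA = Inverse eA
    module eB = Inverse eB

    eA-from-injective : ∀ {i j} → eA.from i ≡ eA.from j → i ≡ j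
    eA-from-injective = Injection.injective (↔⇒↣ (↔-sym eA))

    eB-from-injective : ∀ {i j} → eB.from i ≡ eB.from j → i ≡ j
    eB-from-injective = Injection.injective (↔⇒↣ (↔-sym eB))

  pair-injectiveˡ : ∀ {a a′} → (∀ b → pair a b ≡ pair a′ b) → a ≡ a′
  pair-injectiveˡ {a} {a′} eq = A.x∙y⁻¹≈ε⇒x≈y a a′ (nondegenerateˡ _ λ b → begin
    pair (a A.∙ a′ A.⁻¹) b           ≡⟨ additiveˡ b a (a′ A.⁻¹) ⟩
    pair a b C.∙ pair (a′ A.⁻¹) b    ≡⟨ ≡.cong₂ C._∙_ (eq b) (AdditiveMap.⁻¹-homo A C ≈⇒≡ᴬ ≈⇒≡ᶜ (additiveˡ b) a′) ⟩
    pair a′ b C.∙ pair a′ b C.⁻¹     ≡⟨ C.inverseʳ _ ⟩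
    C.ε                              ∎)
    where open ≡.≡-Reasoning

  pair-injectiveʳ : ∀ {b b′} → (∀ a → pair a b ≡ pair a b′) → b ≡ b′
  pair-injectiveʳ {b} {b′} eq = B.x∙y⁻¹≈ε⇒x≈y b b′ (nondegenerateʳ _ λ a → begin
    pair a (b B.∙ b′ B.⁻¹)           ≡⟨ additiveʳ a b (b′ B.⁻¹) ⟩
    pair a b C.∙ pair a (b′ B.⁻¹)    ≡⟨ ≡.cong₂ C._∙_ (eq a) (AdditiveMap.⁻¹-homo B C ≈⇒≡ᴮ ≈⇒≡ᶜ (additiveʳ a) b′) ⟩
    pair a b′ C.∙ pair a b′ C.⁻¹     ≡⟨ C.inverseʳ _ ⟩
    C.ε                              ∎)
    where open ≡.≡-Reasoning

  nB≤nA : nB ℕ.≤ nA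
  nB≤nA = ≡.subst (ℕ._≤ nA) (List.length-tabulate column)
    (CharactersOfA.characterBound (tabulate column) (All.tabulate⁺ (additiveˡ ∘ eB.from))
      (AllPairs.tabulate⁺ λ i≢j column-i≡column-j → i≢j (eB-from-injective (pair-injectiveʳ column-i≡column-j))))
    where
    column : Fin nB → AbelianGroup.Carrier A → AbelianGroup.Carrier C
    column j a = pair a (eB.from j)

  -- Otherwise f and the nA characters pair a would be nA + 1 ≤ nB ≤ nA distinct characters of B.
  pair-surjective : ∀ f → Additive B C f → Σ (AbelianGroup.Carrier A) λ a → ∀ b → pair a b ≡ f b
  pair-surjective f f+ with Fin.any? (λ i → Fin.all? (λ j → pair (eA.from i) (eB.from j) ≟ f (eB.from j)))
  ... | yes (i , agree) =
    eA.from i , λ b → ≡.subst (λ b → pair (eA.from i) b ≡ f b) (eB.strictlyInverseʳ b) (agree (eB.to b))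
  ... | no  disagree    = ⊥-elim (ℕ.<⇒≱ (ℕ.s≤s nB≤nA) (≡.subst (ℕ._≤ nB) (≡.cong suc (List.length-tabulate row))
      (CharactersOfB.characterBound (f ∷ tabulate row) (f+ ∷ All.tabulate⁺ (additiveʳ ∘ eA.from))
        (All.tabulate⁺ (λ i f≡row-i → disagree (i , λ j → ≡.sym (f≡row-i (eB.from j))))
         ∷ AllPairs.tabulate⁺ λ i≢j row-i≡row-j → i≢j (eA-from-injective (pair-injectiveˡ row-i≡row-j))))))
    where
    row : Fin nA → AbelianGroup.Carrier B → AbelianGroup.Carrier C
    row i = pair (eA.from i)

-- The Heisenberg group

module HeisenbergProperties
    {c ℓ} (R : CommutativeRing c ℓ) (A B : Module R 0ℓ 0ℓ) (C : AbelianGroup 0ℓ 0ℓ) (r : ℕ)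
    (lam : Module.Carrierᴹ A → Module.Carrierᴹ B → AbelianGroup.Carrier C)
    (finA : FiniteModule A) (finB : FiniteModule B) (cyclic : IsCyclicOfOrder C r) (odd : Odd r)
    (biadditive : Heisenberg.Biadditive R A B C r lam)
    (nondegenerate : Heisenberg.NonDegenerate R A B C r lam) where

  open Heisenberg R A B C r lam
  open import Data.Product using (_×_)

  GA GB GC GAB : AbelianGroup 0ℓ 0ℓ
  GA  = ≡-abelianGroup (Module.+ᴹ-abelianGroup A) (proj₁ finA)
  GB  = ≡-abelianGroup (Module.+ᴹ-abelianGroup B) (proj₁ finB)
  GC  = ≡-abelianGroup C (proj₁ cyclic)
  GAB = ≡-abelianGroup (DirectProduct.abelianGroup GA GB) λ (a≡ , b≡) → ×-≡,≡→≡ (a≡ , b≡)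

  private
    module GA where
      open AbelianGroup GA public
      open import Algebra.Properties.AbelianGroup GA public using (xyx⁻¹≈y)
    module GB where
      open AbelianGroup GB public
      open import Algebra.Properties.AbelianGroup GB public using (xyx⁻¹≈y)
    module GAB = AbelianGroup GAB
  open AbelianGroup GC using (_∙_; ε; _⁻¹; identityˡ; identityʳ; inverseˡ; inverseʳ; comm)
  open import Algebra.Properties.AbelianGroup GC using (x∙y⁻¹≈ε⇒x≈y; ⁻¹-involutive; ⁻¹-∙-comm)
  open AbelianGroupSolver GC using (solve; _⊜_; _⊕_; ⊝_; 𝟘)
  open ≡.≡-Reasoning

  private
    module GCᵐ where
      open AbelianGroup GC public using (monoid; commutativeMonoid; rawMonoid)
      open import Algebra.Definitions.RawMonoid rawMonoid public using (_×_)
      open import Algebra.Properties.Monoid.Mult monoid public using (×-homo-+)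
      open import Algebra.Properties.CommutativeMonoid.Mult commutativeMonoid public using (×-distrib-+)
    module Cyclic = CyclicGroup C (proj₁ cyclic) (proj₂ (proj₂ cyclic))
                      (proj₁ (proj₁ (proj₂ cyclic))) (proj₂ (proj₁ (proj₂ cyclic)))
    open Cyclic using (natMul≡×)
    open FiniteAbelianGroup C (proj₁ cyclic) (proj₂ (proj₂ cyclic)) using (×-order)
    ⌈r/2⌉ : ℕ
    ⌈r/2⌉ = ⌊ suc r /2⌋

  half-additive : Additive C C half
  half-additive x y = begin
    half (x ∙ y)                   ≡⟨ natMul≡× ⌈r/2⌉ (x ∙ y) ⟩
    ⌈r/2⌉ GCᵐ.× (x ∙ y)            ≡⟨ GCᵐ.×-distrib-+ x y ⌈r/2⌉ ⟩
    ⌈r/2⌉ GCᵐ.× x ∙ ⌈r/2⌉ GCᵐ.× y  ≡⟨ ≡.cong₂ _∙_ (natMul≡× ⌈r/2⌉ x) (natMul≡× ⌈r/2⌉ y) ⟨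
    half x ∙ half y                ∎

  half+half : ∀ x → half x ∙ half x ≡ x
  half+half x = begin
    half x ∙ half x                ≡⟨ ≡.cong₂ _∙_ (natMul≡× ⌈r/2⌉ x) (natMul≡× ⌈r/2⌉ x) ⟩
    ⌈r/2⌉ GCᵐ.× x ∙ ⌈r/2⌉ GCᵐ.× x  ≡⟨ GCᵐ.×-homo-+ x ⌈r/2⌉ ⌈r/2⌉ ⟨
    (⌈r/2⌉ ℕ.+ ⌈r/2⌉) GCᵐ.× x      ≡⟨ ≡.cong (GCᵐ._× x) (⌊1+n/2⌋+⌊1+n/2⌋≡1+n r odd) ⟩
    x ∙ r GCᵐ.× x                  ≡⟨ ≡.cong (x ∙_) (×-order x) ⟩
    x ∙ ε                          ≡⟨ identityʳ x ⟩
    x                              ∎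

  open AdditiveMap C C (proj₁ cyclic) (proj₁ cyclic) half-additive public
    using () renaming (ε-homo to half-ε; ⁻¹-homo to half-⁻¹)

  half-injective : ∀ {x y} → half x ≡ half y → x ≡ y
  half-injective {x} {y} eq = begin
    x                 ≡⟨ half+half x ⟨
    half x ∙ half x   ≡⟨ ≡.cong₂ _∙_ eq eq ⟩
    half y ∙ half y   ≡⟨ half+half y ⟩
    y                 ∎

  self-inverse⇒ε : ∀ {x} → x ≡ x ⁻¹ → x ≡ ε
  self-inverse⇒ε {x} x≡x⁻¹ = begin
    x                  ≡⟨ half+half x ⟨
    half x ∙ half x    ≡⟨ half-additive x x ⟨
    half (x ∙ x)       ≡⟨ ≡.cong (λ y → half (x ∙ y)) x≡x⁻¹ ⟩
    half (x ∙ x ⁻¹)    ≡⟨ ≡.cong half (inverseʳ x) ⟩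
    half ε             ≡⟨ half-ε ⟩
    ε                  ∎

  lam-additiveˡ : ∀ b → Additive (Module.+ᴹ-abelianGroup A) C (λ a → lam a b)
  lam-additiveˡ b a a′ = proj₁ biadditive a a′ b

  lam-additiveʳ : ∀ a → Additive (Module.+ᴹ-abelianGroup B) C (lam a)
  lam-additiveʳ = proj₂ biadditive

  private
    module LamˡAdditive b = AdditiveMap (Module.+ᴹ-abelianGroup A) C (proj₁ finA) (proj₁ cyclic) (lam-additiveˡ b)
    module LamʳAdditive a = AdditiveMap (Module.+ᴹ-abelianGroup B) C (proj₁ finB) (proj₁ cyclic) (lam-additiveʳ a)

  lam-εʳ : ∀ a → lam a B.0ᴹ ≡ ε
  lam-εʳ a = LamʳAdditive.ε-homo a

  lam-⁻¹ˡ : ∀ a b → lam (A.-ᴹ a) b ≡ lam a b ⁻¹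
  lam-⁻¹ˡ a b = LamˡAdditive.⁻¹-homo b a

  lam-⁻¹ʳ : ∀ a b → lam a (B.-ᴹ b) ≡ lam a b ⁻¹
  lam-⁻¹ʳ a b = LamʳAdditive.⁻¹-homo a b

  δ-additive : ∀ k → Additive GAB GC (δ k)
  δ-additive (a , b) (a₁ , b₁) (a₂ , b₂) = begin
    lam a (b₁ B.+ᴹ b₂) ∙ lam (a₁ A.+ᴹ a₂) b ⁻¹
      ≡⟨ ≡.cong₂ (λ u v → u ∙ v ⁻¹) (lam-additiveʳ a b₁ b₂) (lam-additiveˡ b a₁ a₂) ⟩
    (lam a b₁ ∙ lam a b₂) ∙ (lam a₁ b ∙ lam a₂ b) ⁻¹
      ≡⟨ solve 4 (λ u v w z → (u ⊕ v) ⊕ ⊝ (w ⊕ z) ⊜ (u ⊕ ⊝ w) ⊕ (v ⊕ ⊝ z)) ≡.refl _ _ _ _ ⟩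
    (lam a b₁ ∙ lam a₁ b ⁻¹) ∙ (lam a b₂ ∙ lam a₂ b ⁻¹) ∎

  δ-antisymmetric : ∀ x y → δ y x ≡ δ x y ⁻¹
  δ-antisymmetric (a , b) (a′ , b′) =
    solve 2 (λ u v → u ⊕ ⊝ v ⊜ ⊝ (v ⊕ ⊝ u)) ≡.refl (lam a′ b) (lam a b′)

  h-cong : ∀ {a a′ b b′ z z′} → a ≡ a′ → b ≡ b′ → z ≡ z′ → h a b z ≡ h a′ b′ z′
  h-cong ≡.refl ≡.refl ≡.refl = ≡.refl

  p₃ : H → C.Carrier
  p₃ (_ , _ , z) = z

  -- Coordinates relative to the section D: ⟪ x , z ⟫ = D x · m z, and g = ⟪ π g , ζ g ⟫.
  ⟪_,_⟫ : AB → C.Carrier → H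
  ⟪ (a , b) , z ⟫ = h a b (half (lam a b) ∙ z)

  ζ : H → C.Carrier
  ζ (a , b , z) = z ∙ half (lam a b) ⁻¹

  ⟪π,ζ⟫ : ∀ g → ⟪ π g , ζ g ⟫ ≡ g
  ⟪π,ζ⟫ (a , b , z) = ≡.cong (h a b) (solve 2 (λ u z → u ⊕ (z ⊕ ⊝ u) ⊜ z) ≡.refl (half (lam a b)) z)

  ζ-⟪⟫ : ∀ x z → ζ ⟪ x , z ⟫ ≡ z
  ζ-⟪⟫ (a , b) z = solve 2 (λ u z → u ⊕ z ⊕ ⊝ u ⊜ z) ≡.refl (half (lam a b)) z

  ⟪⟫·m : ∀ x z w → ⟪ x , z ⟫ · m w ≡ ⟪ x , z ∙ w ⟫
  ⟪⟫·m (a , b) z w = h-cong (GA.identityʳ a) (GB.identityʳ b) (begin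
    half (lam a b) ∙ z ∙ w ∙ lam a B.0ᴹ  ≡⟨ ≡.cong (half (lam a b) ∙ z ∙ w ∙_) (lam-εʳ a) ⟩
    half (lam a b) ∙ z ∙ w ∙ ε           ≡⟨ solve 3 (λ u z w → u ⊕ z ⊕ w ⊕ 𝟘 ⊜ u ⊕ (z ⊕ w)) ≡.refl _ z w ⟩
    half (lam a b) ∙ (z ∙ w)             ∎)

  D≡⟪_,ε⟫ : ∀ x → D x ≡ ⟪ x , ε ⟫
  D≡⟪ x ,ε⟫ = ≡.cong (h (proj₁ x) (proj₂ x)) (≡.sym (identityʳ _))

  D·m : ∀ x z → D x · m z ≡ ⟪ x , z ⟫
  D·m x z = begin
    D x · m z        ≡⟨ ≡.cong (_· m z) D≡⟪ x ,ε⟫ ⟩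
    ⟪ x , ε ⟫ · m z  ≡⟨ ⟪⟫·m x ε z ⟩
    ⟪ x , ε ∙ z ⟫    ≡⟨ ≡.cong ⟪ x ,_⟫ (identityˡ z) ⟩
    ⟪ x , z ⟫        ∎

  half-diag-+ : ∀ a b a′ b′ → half (lam (a A.+ᴹ a′) (b B.+ᴹ b′))
              ≡ half (lam a b) ∙ half (lam a′ b′) ∙ half (lam a b′) ∙ half (lam a′ b)
  half-diag-+ a b a′ b′ = begin
    half (lam (a A.+ᴹ a′) (b B.+ᴹ b′))
      ≡⟨ ≡.cong half (lam-additiveˡ _ a a′) ⟩
    half (lam a (b B.+ᴹ b′) ∙ lam a′ (b B.+ᴹ b′))
      ≡⟨ ≡.cong half (≡.cong₂ _∙_ (lam-additiveʳ a b b′) (lam-additiveʳ a′ b b′)) ⟩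
    half ((lam a b ∙ lam a b′) ∙ (lam a′ b ∙ lam a′ b′))
      ≡⟨ ≡.cong half (solve 4 (λ u v w z → (u ⊕ v) ⊕ (w ⊕ z) ⊜ u ⊕ z ⊕ v ⊕ w) ≡.refl _ _ _ _) ⟩
    half (lam a b ∙ lam a′ b′ ∙ lam a b′ ∙ lam a′ b)
      ≡⟨ half-additive _ _ ⟩
    half (lam a b ∙ lam a′ b′ ∙ lam a b′) ∙ half (lam a′ b)
      ≡⟨ ≡.cong (_∙ half (lam a′ b)) (half-additive _ _) ⟩
    half (lam a b ∙ lam a′ b′) ∙ half (lam a b′) ∙ half (lam a′ b)
      ≡⟨ ≡.cong (λ u → u ∙ half (lam a b′) ∙ half (lam a′ b)) (half-additive _ _) ⟩
    half (lam a b) ∙ half (lam a′ b′) ∙ half (lam a b′) ∙ half (lam a′ b) ∎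

  half-δ : ∀ a b a′ b′ → half (δ (a , b) (a′ , b′)) ≡ half (lam a b′) ∙ half (lam a′ b) ⁻¹
  half-δ a b a′ b′ = ≡.trans (half-additive _ _) (≡.cong (half (lam a b′) ∙_) (half-⁻¹ (lam a′ b)))

  -- The cocycle λ(a, b′) of H splits as half of the symmetric part plus half of δ.
  ⟪⟫·⟪⟫ : ∀ x z y w → ⟪ x , z ⟫ · ⟪ y , w ⟫ ≡ ⟪ x +AB y , z ∙ w ∙ half (δ x y) ⟫
  ⟪⟫·⟪⟫ (a , b) z (a′ , b′) w = ≡.cong (h (a A.+ᴹ a′) (b B.+ᴹ b′)) (begin
    (P ∙ z) ∙ (P′ ∙ w) ∙ lam a b′
      ≡⟨ ≡.cong ((P ∙ z) ∙ (P′ ∙ w) ∙_) (half+half (lam a b′)) ⟨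
    (P ∙ z) ∙ (P′ ∙ w) ∙ (Q ∙ Q)
      ≡⟨ solve 6 (λ P P′ Q Q′ z w → (P ⊕ z) ⊕ (P′ ⊕ w) ⊕ (Q ⊕ Q)
                                  ⊜ P ⊕ P′ ⊕ Q ⊕ Q′ ⊕ (z ⊕ w ⊕ (Q ⊕ ⊝ Q′))) ≡.refl P P′ Q Q′ z w ⟩
    P ∙ P′ ∙ Q ∙ Q′ ∙ (z ∙ w ∙ (Q ∙ Q′ ⁻¹))
      ≡⟨ ≡.cong₂ (λ u v → u ∙ (z ∙ w ∙ v)) (half-diag-+ a b a′ b′) (half-δ a b a′ b′) ⟨
    half (lam (a A.+ᴹ a′) (b B.+ᴹ b′)) ∙ (z ∙ w ∙ half (δ (a , b) (a′ , b′))) ∎)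
    where
    P P′ Q Q′ : C.Carrier
    P  = half (lam a b)
    P′ = half (lam a′ b′)
    Q  = half (lam a b′)
    Q′ = half (lam a′ b)

  ζ-· : ∀ g g′ → ζ (g · g′) ≡ ζ g ∙ ζ g′ ∙ half (δ (π g) (π g′))
  ζ-· g g′ = begin
    ζ (g · g′)
      ≡⟨ ≡.cong ζ (≡.cong₂ _·_ (⟪π,ζ⟫ g) (⟪π,ζ⟫ g′)) ⟨
    ζ (⟪ π g , ζ g ⟫ · ⟪ π g′ , ζ g′ ⟫)
      ≡⟨ ≡.cong ζ (⟪⟫·⟪⟫ (π g) (ζ g) (π g′) (ζ g′)) ⟩
    ζ ⟪ π g +AB π g′ , ζ g ∙ ζ g′ ∙ half (δ (π g) (π g′)) ⟫
      ≡⟨ ζ-⟪⟫ _ _ ⟩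
    ζ g ∙ ζ g′ ∙ half (δ (π g) (π g′))
      ∎

  induced : (AB → AB) → (AB → C.Carrier) → H → H
  induced α η g = ⟪ α (π g) , η (π g) ∙ ζ g ⟫

  induced-cong : ∀ {α α′ η η′} → α ≗ α′ → η ≗ η′ → induced α η ≗ induced α′ η′
  induced-cong α≗α′ η≗η′ g = ≡.cong₂ (λ x z → ⟪ x , z ∙ ζ g ⟫) (α≗α′ (π g)) (η≗η′ (π g))

  induced-id : induced id (λ _ → ε) ≗ id
  induced-id g = ≡.trans (≡.cong ⟪ π g ,_⟫ (identityˡ (ζ g))) (⟪π,ζ⟫ g)

  induced-∘ : ∀ α η β θ → induced α η ∘ induced β θ ≗ induced (α ∘ β) (λ x → θ x ∙ η (β x))
  induced-∘ α η β θ g = ≡.cong ⟪ α (β (π g)) ,_⟫ (begin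
    η (β (π g)) ∙ ζ (induced β θ g)      ≡⟨ ≡.cong (η (β (π g)) ∙_) (ζ-⟪⟫ _ _) ⟩
    η (β (π g)) ∙ (θ (π g) ∙ ζ g)  ≡⟨ solve 3 (λ u v w → u ⊕ (v ⊕ w) ⊜ v ⊕ u ⊕ w) ≡.refl _ _ _ ⟩
    θ (π g) ∙ η (β (π g)) ∙ ζ g    ∎)

  p₃-inv-D· : ∀ y w → p₃ (inv (D y) · ⟪ y , w ⟫) ≡ w
  p₃-inv-D· (a , b) w = begin
    (half (lam a b) ⁻¹ ∙ lam a b) ∙ (half (lam a b) ∙ w) ∙ lam (A.-ᴹ a) b
      ≡⟨ ≡.cong ((half (lam a b) ⁻¹ ∙ lam a b) ∙ (half (lam a b) ∙ w) ∙_) (lam-⁻¹ˡ a b) ⟩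
    (half (lam a b) ⁻¹ ∙ lam a b) ∙ (half (lam a b) ∙ w) ∙ lam a b ⁻¹
      ≡⟨ solve 3 (λ u q w → (⊝ u ⊕ q) ⊕ (u ⊕ w) ⊕ ⊝ q ⊜ w) ≡.refl _ _ w ⟩
    w ∎

  eta-induced : ∀ α η → eta (induced α η) ≗ η
  eta-induced α η x = begin
    eta (induced α η) x
      ≡⟨ p₃-inv-D· (α x) _ ⟩
    η x ∙ ζ (D x)
      ≡⟨ ≡.cong (λ g → η x ∙ ζ g) D≡⟪ x ,ε⟫ ⟩
    η x ∙ ζ ⟪ x , ε ⟫
      ≡⟨ ≡.cong (η x ∙_) (ζ-⟪⟫ x ε) ⟩
    η x ∙ ε
      ≡⟨ identityʳ (η x) ⟩
    η x
      ∎

  eta-cong : ∀ {f f′} → f ≗ f′ → eta f ≗ eta f′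
  eta-cong f≗f′ x = ≡.cong₂ (λ u v → p₃ (inv (D (π u)) · v)) (f≗f′ _) (f≗f′ _)

  bar-cong : ∀ {f f′} → f ≗ f′ → bar f ≗ bar f′
  bar-cong f≗f′ x = ≡.cong π (f≗f′ _)

  induced-fixes-centre : ∀ {α η} → α GAB.ε ≡ GAB.ε → η GAB.ε ≡ ε → ∀ z → induced α η (m z) ≡ m z
  induced-fixes-centre {α} {η} α0≡0 η0≡ε z = begin
    ⟪ α GAB.ε , η GAB.ε ∙ ζ (m z) ⟫  ≡⟨ ≡.cong₂ (λ x y → ⟪ x , y ∙ ζ (m z) ⟫) α0≡0 η0≡ε ⟩
    ⟪ GAB.ε , ε ∙ ζ (m z) ⟫          ≡⟨ ≡.cong ⟪ GAB.ε ,_⟫ (identityˡ _) ⟩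
    ⟪ π (m z) , ζ (m z) ⟫            ≡⟨ ⟪π,ζ⟫ (m z) ⟩
    m z                              ∎

  Preservesδ : (AB → AB) → Set
  Preservesδ α = ∀ x y → δ (α x) (α y) ≡ δ x y

  Multiplicative : (H → H) → Set
  Multiplicative f = ∀ g g′ → f (g · g′) ≡ f g · f g′

  induced-multiplicative : ∀ {α η} → Additive GAB GAB α → Preservesδ α → Additive GAB GC η →
                           Multiplicative (induced α η)
  induced-multiplicative {α} {η} α+ α-δ η+ g g′ = ≡.sym (begin
    induced α η g · induced α η g′
      ≡⟨ ⟪⟫·⟪⟫ (α x) (η x ∙ ζ g) (α y) (η y ∙ ζ g′) ⟩
    ⟪ α x +AB α y , (η x ∙ ζ g) ∙ (η y ∙ ζ g′) ∙ half (δ (α x) (α y)) ⟫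
      ≡⟨ ≡.cong₂ ⟪_,_⟫ (α+ x y) (≡.cong (λ d → (η x ∙ ζ g) ∙ (η y ∙ ζ g′) ∙ half d) (≡.sym (α-δ x y))) ⟨
    ⟪ α (x +AB y) , (η x ∙ ζ g) ∙ (η y ∙ ζ g′) ∙ half (δ x y) ⟫
      ≡⟨ ≡.cong ⟪ α (x +AB y) ,_⟫
           (solve 5 (λ a b c d e → (a ⊕ c) ⊕ (b ⊕ d) ⊕ e ⊜ (a ⊕ b) ⊕ (c ⊕ d ⊕ e)) ≡.refl _ _ _ _ _) ⟩
    ⟪ α (x +AB y) , (η x ∙ η y) ∙ (ζ g ∙ ζ g′ ∙ half (δ x y)) ⟫
      ≡⟨ ≡.cong₂ (λ u v → ⟪ α (x +AB y) , u ∙ v ⟫) (η+ x y) (ζ-· g g′) ⟨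
    induced α η (g · g′) ∎)
    where
    x y : AB
    x = π g
    y = π g′

  -- Comparing central coordinates of induced α η (⟪ x , ε ⟫ · ⟪ y , ε ⟫) gives
  -- η (x + y) − η x − η y = ½ δ (α x) (α y) − ½ δ x y: the left side is symmetric in x and y,
  -- the right side antisymmetric, so both vanish because C has odd order.
  module _ {α η} (multiplicative : Multiplicative (induced α η)) where

    private
      defect : AB → AB → C.Carrier
      defect x y = η (x +AB y) ∙ (η x ∙ η y) ⁻¹

      skew : AB → AB → C.Carrier
      skew x y = half (δ (α x) (α y)) ∙ half (δ x y) ⁻¹

      defect≡skew : ∀ x y → defect x y ≡ skew x y
      defect≡skew x y = begin
        η (x +AB y) ∙ (η x ∙ η y) ⁻¹
          ≡⟨ solve 6 (λ L X Y a b d → L ⊕ ⊝ (X ⊕ Y) ⊜ (L ⊕ (a ⊕ b ⊕ d)) ⊕ ⊝ ((X ⊕ Y) ⊕ (a ⊕ b ⊕ d)))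
                     ≡.refl _ _ _ _ _ _ ⟩
        (η (x +AB y) ∙ (ζ g ∙ ζ g′ ∙ d)) ∙ ((η x ∙ η y) ∙ (ζ g ∙ ζ g′ ∙ d)) ⁻¹
          ≡⟨ ≡.cong (_∙ ((η x ∙ η y) ∙ (ζ g ∙ ζ g′ ∙ d)) ⁻¹) central ⟩
        ((η x ∙ ζ g) ∙ (η y ∙ ζ g′) ∙ d′) ∙ ((η x ∙ η y) ∙ (ζ g ∙ ζ g′ ∙ d)) ⁻¹
          ≡⟨ solve 6 (λ X Y a b d d′ → ((X ⊕ a) ⊕ (Y ⊕ b) ⊕ d′) ⊕ ⊝ ((X ⊕ Y) ⊕ (a ⊕ b ⊕ d)) ⊜ d′ ⊕ ⊝ d)
                     ≡.refl _ _ _ _ _ _ ⟩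
        d′ ∙ d ⁻¹ ∎
        where
        g g′ : H
        g  = ⟪ x , ε ⟫
        g′ = ⟪ y , ε ⟫
        d d′ : C.Carrier
        d  = half (δ x y)
        d′ = half (δ (α x) (α y))
        central : η (x +AB y) ∙ (ζ g ∙ ζ g′ ∙ d) ≡ (η x ∙ ζ g) ∙ (η y ∙ ζ g′) ∙ d′
        central = begin
          η (x +AB y) ∙ (ζ g ∙ ζ g′ ∙ d)   ≡⟨ ≡.cong (η (x +AB y) ∙_) (ζ-· g g′) ⟨
          η (x +AB y) ∙ ζ (g · g′)         ≡⟨ ζ-⟪⟫ _ _ ⟨
          ζ (induced α η (g · g′))               ≡⟨ ≡.cong ζ (multiplicative g g′) ⟩
          ζ (induced α η g · induced α η g′)           ≡⟨ ζ-· (induced α η g) (induced α η g′) ⟩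
          ζ (induced α η g) ∙ ζ (induced α η g′) ∙ d′  ≡⟨ ≡.cong₂ (λ u v → u ∙ v ∙ d′) (ζ-⟪⟫ _ _) (ζ-⟪⟫ _ _) ⟩
          (η x ∙ ζ g) ∙ (η y ∙ ζ g′) ∙ d′  ∎

      skew-antisymmetric : ∀ x y → skew y x ≡ skew x y ⁻¹
      skew-antisymmetric x y = begin
        half (δ (α y) (α x)) ∙ half (δ y x) ⁻¹
          ≡⟨ ≡.cong₂ (λ u v → half u ∙ half v ⁻¹) (δ-antisymmetric (α x) (α y)) (δ-antisymmetric x y) ⟩
        half (δ (α x) (α y) ⁻¹) ∙ half (δ x y ⁻¹) ⁻¹
          ≡⟨ ≡.cong₂ (λ u v → u ∙ v ⁻¹) (half-⁻¹ _) (half-⁻¹ _) ⟩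
        half (δ (α x) (α y)) ⁻¹ ∙ half (δ x y) ⁻¹ ⁻¹
          ≡⟨ solve 2 (λ u v → ⊝ u ⊕ ⊝ ⊝ v ⊜ ⊝ (u ⊕ ⊝ v)) ≡.refl _ _ ⟩
        skew x y ⁻¹ ∎

      defect-symmetric : ∀ x y → defect y x ≡ defect x y
      defect-symmetric x y = ≡.cong₂ (λ u v → η u ∙ v ⁻¹) (GAB.comm y x) (comm (η y) (η x))

      defect≡ε : ∀ x y → defect x y ≡ ε
      defect≡ε x y = self-inverse⇒ε (begin
        defect x y      ≡⟨ defect-symmetric x y ⟨
        defect y x      ≡⟨ defect≡skew y x ⟩
        skew y x        ≡⟨ skew-antisymmetric x y ⟩
        skew x y ⁻¹     ≡⟨ ≡.cong _⁻¹ (defect≡skew x y) ⟨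
        defect x y ⁻¹   ∎)

    multiplicative⇒η-additive : Additive GAB GC η
    multiplicative⇒η-additive x y = x∙y⁻¹≈ε⇒x≈y _ _ (defect≡ε x y)

    multiplicative⇒α-preserves-δ : Preservesδ α
    multiplicative⇒α-preserves-δ x y =
      half-injective (x∙y⁻¹≈ε⇒x≈y _ _ (≡.trans (≡.sym (defect≡skew x y)) (defect≡ε x y)))

  IsCentreFixingHom : (H → H) → Set
  IsCentreFixingHom f = (∀ z → f (m z) ≡ m z) × Multiplicative f

  lift : AB → H
  lift x = h (proj₁ x) (proj₂ x) ε

  lift·m : ∀ g → lift (π g) · m (p₃ g) ≡ g
  lift·m (a , b , z) = h-cong (GA.identityʳ a) (GB.identityʳ b)
    (≡.trans (≡.cong₂ _∙_ (identityˡ z) (lam-εʳ a)) (identityʳ z))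

  module CentreFixingHom {f} (f-cf : IsCentreFixingHom f) where

    private
      f-centre : ∀ z → f (m z) ≡ m z
      f-centre = proj₁ f-cf
      f-hom : Multiplicative f
      f-hom = proj₂ f-cf

    π∘f : ∀ g → π (f g) ≡ bar f (π g)
    π∘f g = begin
      π (f g)                               ≡⟨ ≡.cong (π ∘ f) (lift·m g) ⟨
      π (f (lift (π g) · m (p₃ g)))         ≡⟨ ≡.cong π (f-hom _ _) ⟩
      π (f (lift (π g)) · f (m (p₃ g)))     ≡⟨ ≡.cong (λ u → π (f (lift (π g)) · u)) (f-centre _) ⟩
      π (f (lift (π g)) · m (p₃ g))         ≡⟨ GAB.identityʳ _ ⟩
      bar f (π g)                           ∎

    eta≡ζ∘f∘D : ∀ x → eta f x ≡ ζ (f (D x))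
    eta≡ζ∘f∘D x = begin
      eta f x
        ≡⟨ ≡.cong (λ u → p₃ (inv (D (bar f x)) · u)) (⟪π,ζ⟫ (f (D x))) ⟨
      p₃ (inv (D (bar f x)) · ⟪ π (f (D x)) , ζ (f (D x)) ⟫)
        ≡⟨ ≡.cong (λ y → p₃ (inv (D (bar f x)) · ⟪ y , ζ (f (D x)) ⟫)) (π∘f (D x)) ⟩
      p₃ (inv (D (bar f x)) · ⟪ bar f x , ζ (f (D x)) ⟫)
        ≡⟨ p₃-inv-D· _ _ ⟩
      ζ (f (D x))
        ∎

    representation : f ≗ induced (bar f) (eta f)
    representation g = begin
      f g
        ≡⟨ ≡.cong f (≡.trans (D·m (π g) (ζ g)) (⟪π,ζ⟫ g)) ⟨
      f (D (π g) · m (ζ g))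
        ≡⟨ f-hom _ _ ⟩
      f (D (π g)) · f (m (ζ g))
        ≡⟨ ≡.cong₂ _·_ (≡.sym (⟪π,ζ⟫ _)) (f-centre _) ⟩
      ⟪ π (f (D (π g))) , ζ (f (D (π g))) ⟫ · m (ζ g)
        ≡⟨ ⟪⟫·m _ _ _ ⟩
      ⟪ π (f (D (π g))) , ζ (f (D (π g))) ∙ ζ g ⟫
        ≡⟨ ≡.cong₂ (λ y w → ⟪ y , w ∙ ζ g ⟫) (π∘f (D (π g))) (≡.sym (eta≡ζ∘f∘D (π g))) ⟩
      induced (bar f) (eta f) g
        ∎

    private
      representation-multiplicative : Multiplicative (induced (bar f) (eta f))
      representation-multiplicative g g′ = begin
        induced (bar f) (eta f) (g · g′)                 ≡⟨ representation _ ⟨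
        f (g · g′)                                 ≡⟨ f-hom g g′ ⟩
        f g · f g′                                 ≡⟨ ≡.cong₂ _·_ (representation g) (representation g′) ⟩
        induced (bar f) (eta f) g · induced (bar f) (eta f) g′ ∎

    bar-preserves-δ : Preservesδ (bar f)
    bar-preserves-δ = multiplicative⇒α-preserves-δ representation-multiplicative

    eta-additive : Additive GAB GC (eta f)
    eta-additive = multiplicative⇒η-additive representation-multiplicative

  bar-∘ : ∀ {f} → IsCentreFixingHom f → ∀ f′ → bar (f ∘ f′) ≗ bar f ∘ bar f′
  bar-∘ f-cf f′ x = CentreFixingHom.π∘f f-cf (f′ (lift x))

  eta-∘ : ∀ {f f′} → IsCentreFixingHom f → IsCentreFixingHom f′ →
          ∀ x → eta (f ∘ f′) x ≡ eta f′ x ∙ eta f (bar f′ x)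
  eta-∘ {f} {f′} f-cf f′-cf x = begin
    eta (f ∘ f′) x               ≡⟨ eta-cong f∘f′≗induced x ⟩
    eta (induced (bar f ∘ bar f′) η) x ≡⟨ eta-induced (bar f ∘ bar f′) η x ⟩
    eta f′ x ∙ eta f (bar f′ x)  ∎
    where
    η : AB → C.Carrier
    η x = eta f′ x ∙ eta f (bar f′ x)
    f∘f′≗induced : f ∘ f′ ≗ induced (bar f ∘ bar f′) η
    f∘f′≗induced g = begin
      f (f′ g)
        ≡⟨ CentreFixingHom.representation f-cf (f′ g) ⟩
      induced (bar f) (eta f) (f′ g)
        ≡⟨ ≡.cong (induced (bar f) (eta f)) (CentreFixingHom.representation f′-cf g) ⟩
      induced (bar f) (eta f) (induced (bar f′) (eta f′) g)
        ≡⟨ induced-∘ (bar f) (eta f) (bar f′) (eta f′) g ⟩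
      induced (bar f ∘ bar f′) η g
        ∎

  ∘-centreFixing : ∀ {f f′} → IsCentreFixingHom f → IsCentreFixingHom f′ → IsCentreFixingHom (f ∘ f′)
  ∘-centreFixing {f} {f′} (f-centre , f-hom) (f′-centre , f′-hom) =
    (λ z → ≡.trans (≡.cong f (f′-centre z)) (f-centre z)) ,
    (λ g g′ → ≡.trans (≡.cong f (f′-hom g g′)) (f-hom _ _))

  to-centreFixing : (φ : Aut0) → IsCentreFixingHom (to (aut φ))
  to-centreFixing φ = proj₁ (isAut0 φ) , hom (aut φ)

  from-centreFixing : (φ : Aut0) → IsCentreFixingHom (from (aut φ))
  from-centreFixing φ =
    (λ z → ≡.trans (≡.cong (from (aut φ)) (≡.sym (proj₁ (isAut0 φ) z))) (from∘to (aut φ) (m z))) ,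
    (λ g g′ → begin
      from (aut φ) (g · g′)
        ≡⟨ ≡.cong₂ (λ u v → from (aut φ) (u · v)) (to∘from (aut φ) g) (to∘from (aut φ) g′) ⟨
      from (aut φ) (to (aut φ) (from (aut φ) g) · to (aut φ) (from (aut φ) g′))
        ≡⟨ ≡.cong (from (aut φ)) (hom (aut φ) _ _) ⟨
      from (aut φ) (to (aut φ) (from (aut φ) g · from (aut φ) g′))
        ≡⟨ from∘to (aut φ) _ ⟩
      from (aut φ) g · from (aut φ) g′
        ∎)

  bar-from∘to : (φ : Aut0) → bar (from (aut φ)) ∘ bar (to (aut φ)) ≗ id
  bar-from∘to φ x =
    ≡.trans (≡.sym (bar-∘ (from-centreFixing φ) (to (aut φ)) x)) (≡.cong π (from∘to (aut φ) _))

  bar-to∘from : (φ : Aut0) → bar (to (aut φ)) ∘ bar (from (aut φ)) ≗ id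
  bar-to∘from φ x =
    ≡.trans (≡.sym (bar-∘ (to-centreFixing φ) (from (aut φ)) x)) (≡.cong π (to∘from (aut φ) _))

  inverses-agree : ∀ {f f′ g g′ : AB → AB} → g ∘ f ≗ id → f′ ∘ g′ ≗ id → f ≗ f′ → g ≗ g′
  inverses-agree {f} {f′} {g} {g′} g∘f f′∘g′ f≗f′ x = begin
    g x             ≡⟨ ≡.cong g (f′∘g′ x) ⟨
    g (f′ (g′ x))   ≡⟨ ≡.cong g (f≗f′ (g′ x)) ⟨
    g (f (g′ x))    ≡⟨ g∘f (g′ x) ⟩
    g′ x            ∎

  inverse-isRLinear : ∀ {f g} → g ∘ f ≗ id → f ∘ g ≗ id → IsRLinear f → IsRLinear g
  inverse-isRLinear {f} {g} g∘f f∘g (f-+ , f-*) =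
    (λ x y → ≡.trans (≡.cong g (≡.cong₂ _+AB_ (≡.sym (f∘g x)) (≡.sym (f∘g y))))
                     (≡.trans (≡.cong g (≡.sym (f-+ _ _))) (g∘f _))) ,
    (λ s x → ≡.trans (≡.cong (λ y → g (s *AB y)) (≡.sym (f∘g x)))
                     (≡.trans (≡.cong g (≡.sym (f-* s _))) (g∘f _)))

  inverse-preserves-δ : ∀ {f g} → f ∘ g ≗ id → Preservesδ f → Preservesδ g
  inverse-preserves-δ {f} {g} f∘g f-δ x y =
    ≡.trans (≡.sym (f-δ (g x) (g y))) (≡.cong₂ δ (f∘g x) (f∘g y))

  swap : ABMap → ABMap
  swap α = record { fw = bw α ; bw = fw α }

  swap-isSp : ∀ {α} → IsSp α → IsSp (swap α)
  swap-isSp (bw∘fw , fw∘bw , linear , preserves) =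
    fw∘bw , bw∘fw , inverse-isRLinear bw∘fw fw∘bw linear , inverse-preserves-δ fw∘bw preserves

  barMap-isSp : (φ : Aut0) → IsSp (barMap (aut φ))
  barMap-isSp φ = bar-from∘to φ , bar-to∘from φ , proj₂ (isAut0 φ) ,
                  CentreFixingHom.bar-preserves-δ (to-centreFixing φ)

  additive⇒ε-fixed : ∀ {α} → Additive GAB GAB α → α GAB.ε ≡ GAB.ε
  additive⇒ε-fixed = AdditiveMap.ε-homo GAB GAB id id

  isHom⇒ε↦ε : ∀ {η} → IsHom η → η GAB.ε ≡ ε
  isHom⇒ε↦ε = AdditiveMap.ε-homo GAB C id (proj₁ cyclic)

  automorphism : (α : ABMap) → IsSp α → (η : AB → C.Carrier) → IsHom η → Aut0
  automorphism α (bw∘fw , fw∘bw , linear , preserves) η η+ = record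
    { aut = record
      { to      = induced (fw α) η
      ; from    = induced (bw α) η⁻
      ; from∘to = λ g → ≡.trans (induced-∘ (bw α) η⁻ (fw α) η g)
                          (≡.trans (induced-cong bw∘fw η∙η⁻∘fw≗ε g) (induced-id g))
      ; to∘from = λ g → ≡.trans (induced-∘ (fw α) η (bw α) η⁻ g)
                          (≡.trans (induced-cong fw∘bw η⁻∙η∘bw≗ε g) (induced-id g))
      ; hom     = induced-multiplicative (proj₁ linear) preserves η+
      }
    ; isAut0 = induced-fixes-centre {fw α} {η} (additive⇒ε-fixed (proj₁ linear)) (isHom⇒ε↦ε η+) , linear
    }
    where
    η⁻ : AB → C.Carrier
    η⁻ y = η (bw α y) ⁻¹
    η∙η⁻∘fw≗ε : ∀ x → η x ∙ η⁻ (fw α x) ≡ ε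
    η∙η⁻∘fw≗ε x = ≡.trans (≡.cong (λ y → η x ∙ η y ⁻¹) (bw∘fw x)) (inverseʳ (η x))
    η⁻∙η∘bw≗ε : ∀ y → η⁻ y ∙ η (bw α y) ≡ ε
    η⁻∙η∘bw≗ε y = inverseˡ (η (bw α y))

  idSp-isSp : IsSp idSp
  idSp-isSp = (λ _ → ≡.refl) , (λ _ → ≡.refl) , ((λ _ _ → ≡.refl) , (λ _ _ → ≡.refl)) ,
              (λ _ _ → ≡.refl)

  conj≡induced : ∀ k g → k · g · inv k ≡ induced id (δ (π k)) g
  conj≡induced (k₁ , k₂ , k₃) (g₁ , g₂ , g₃) = h-cong (GA.xyx⁻¹≈y k₁ g₁) (GB.xyx⁻¹≈y k₂ g₂) (begin
      (k₃ ∙ g₃ ∙ lam k₁ g₂) ∙ (k₃ ⁻¹ ∙ lam k₁ k₂) ∙ lam (k₁ A.+ᴹ g₁) (B.-ᴹ k₂)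
        ≡⟨ ≡.cong ((k₃ ∙ g₃ ∙ lam k₁ g₂) ∙ (k₃ ⁻¹ ∙ lam k₁ k₂) ∙_)
                  (≡.trans (lam-additiveˡ _ k₁ g₁) (≡.cong₂ _∙_ (lam-⁻¹ʳ k₁ k₂) (lam-⁻¹ʳ g₁ k₂))) ⟩
      (k₃ ∙ g₃ ∙ lam k₁ g₂) ∙ (k₃ ⁻¹ ∙ lam k₁ k₂) ∙ (lam k₁ k₂ ⁻¹ ∙ lam g₁ k₂ ⁻¹)
        ≡⟨ solve 6 (λ k₃ g₃ u v w q → (k₃ ⊕ g₃ ⊕ u) ⊕ (⊝ k₃ ⊕ v) ⊕ (⊝ v ⊕ ⊝ w)
                                    ⊜ q ⊕ ((u ⊕ ⊝ w) ⊕ (g₃ ⊕ ⊝ q)))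
                   ≡.refl k₃ g₃ (lam k₁ g₂) (lam k₁ k₂) (lam g₁ k₂) (half (lam g₁ g₂)) ⟩
      half (lam g₁ g₂) ∙ ((lam k₁ g₂ ∙ lam g₁ k₂ ⁻¹) ∙ (g₃ ∙ half (lam g₁ g₂) ⁻¹)) ∎)

  conjugation : AB → Inn
  conjugation k = record
    { innAut     = aut (automorphism idSp idSp-isSp (δ k) (δ-additive k))
    ; conjugator = lift k
    ; isConj     = λ g → ≡.sym (conj≡induced (lift k) g)
    }

  inner-induced : (χ : Inn) → to (innAut χ) ≗ induced id (δ (π (conjugator χ)))
  inner-induced χ g = ≡.trans (isConj χ g) (conj≡induced (conjugator χ) g)

  inner-bar : (χ : Inn) → bar (to (innAut χ)) ≗ id
  inner-bar χ x = ≡.cong π (inner-induced χ (lift x))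

  inner-centreFixing : (χ : Inn) → IsCentreFixingHom (to (innAut χ))
  inner-centreFixing χ =
    (λ z → ≡.trans (inner-induced χ (m z))
                   (induced-fixes-centre {id} {δ (π (conjugator χ))} ≡.refl
                      (isHom⇒ε↦ε (δ-additive (π (conjugator χ)))) z)) ,
    hom (innAut χ)

  inner-isAut0 : (χ : Inn) → IsAut0 (innAut χ)
  inner-isAut0 χ = proj₁ (inner-centreFixing χ) ,
    (λ x y → ≡.trans (inner-bar χ _) (≡.sym (≡.cong₂ _+AB_ (inner-bar χ x) (inner-bar χ y)))) ,
    (λ s x → ≡.trans (inner-bar χ _) (≡.sym (≡.cong (s *AB_) (inner-bar χ x))))

  private
    _≟ᶜ_ : DecidableEquality C.Carrier
    _≟ᶜ_ = via-injection (↔⇒↣ (proj₂ (proj₂ cyclic))) Fin._≟_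
    module DualityAB = PairingDuality (Module.+ᴹ-abelianGroup A) (Module.+ᴹ-abelianGroup B) C
      (proj₁ finA) (proj₁ finB) (proj₁ cyclic) (proj₂ (proj₂ finA)) (proj₂ (proj₂ finB))
      Cyclic.smallTorsion _≟ᶜ_ lam lam-additiveˡ lam-additiveʳ (proj₁ nondegenerate) (proj₂ nondegenerate)
    module DualityBA = PairingDuality (Module.+ᴹ-abelianGroup B) (Module.+ᴹ-abelianGroup A) C
      (proj₁ finB) (proj₁ finA) (proj₁ cyclic) (proj₂ (proj₂ finB)) (proj₂ (proj₂ finA))
      Cyclic.smallTorsion _≟ᶜ_ (λ b a → lam a b) lam-additiveʳ lam-additiveˡ
      (proj₂ nondegenerate) (proj₁ nondegenerate)

  -- With λ(a₀, ·) = η(0, ·) and λ(·, b₀) = −η(·, 0):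
  -- δ (a₀ , b₀) (a , b) = η (0 , b) + η (a , 0) = η (a , b).
  δ-surjective : ∀ η → IsHom η → Σ AB λ k → η ≗ δ k
  δ-surjective η η+ = (proj₁ column , proj₁ row) , λ (a , b) → begin
    η (a , b)
      ≡⟨ ≡.cong η (≡.cong₂ _,_ (GA.identityˡ a) (GB.identityʳ b)) ⟨
    η ((A.0ᴹ , b) +AB (a , B.0ᴹ))
      ≡⟨ η+ _ _ ⟩
    η (A.0ᴹ , b) ∙ η (a , B.0ᴹ)
      ≡⟨ ≡.cong₂ _∙_ (proj₂ column b) (≡.trans (≡.cong _⁻¹ (proj₂ row a)) (⁻¹-involutive _)) ⟨
    lam (proj₁ column) b ∙ lam a (proj₁ row) ⁻¹
      ∎
    where
    column : Σ A.Carrierᴹ λ a₀ → ∀ b → lam a₀ b ≡ η (A.0ᴹ , b)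
    column = DualityAB.pair-surjective (λ b → η (A.0ᴹ , b))
      (λ b b′ → ≡.trans (≡.cong (λ a → η (a , b B.+ᴹ b′)) (≡.sym (GA.identityˡ A.0ᴹ))) (η+ _ _))
    row : Σ B.Carrierᴹ λ b₀ → ∀ a → lam a b₀ ≡ η (a , B.0ᴹ) ⁻¹
    row = DualityBA.pair-surjective (λ a → η (a , B.0ᴹ) ⁻¹)
      (λ a a′ → ≡.trans (≡.cong (λ b → η (a A.+ᴹ a′ , b) ⁻¹) (≡.sym (GB.identityˡ B.0ᴹ)))
                        (≡.trans (≡.cong _⁻¹ (η+ _ _)) (≡.sym (⁻¹-∙-comm _ _))))

  acts-trivially⇒inner : ∀ {f} → IsCentreFixingHom f → bar f ≗ id → Σ Inn λ χ → f ≗ to (innAut χ)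
  acts-trivially⇒inner {f} f-cf bar≗id = conjugation k , λ g →
    ≡.trans (CentreFixingHom.representation f-cf g) (induced-cong bar≗id eta≗δk g)
    where
    open CentreFixingHom f-cf using (eta-additive)
    k : AB
    k = proj₁ (δ-surjective (eta f) eta-additive)
    eta≗δk : eta f ≗ δ k
    eta≗δk = proj₂ (δ-surjective (eta f) eta-additive)

  same-bar⇒≈Out : ∀ (φ ψ : Aut0) → bar (to (aut φ)) ≗ bar (to (aut ψ)) → φ ≈Out ψ
  same-bar⇒≈Out φ ψ bar-φ≗bar-ψ = proj₁ inner , λ g →
    ≡.trans (≡.cong (to (aut φ)) (≡.sym (from∘to (aut ψ) g))) (proj₂ inner (to (aut ψ) g))
    where
    bar-φψ⁻¹≗id : bar (to (aut φ) ∘ from (aut ψ)) ≗ id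
    bar-φψ⁻¹≗id x = begin
      bar (to (aut φ) ∘ from (aut ψ)) x            ≡⟨ bar-∘ (to-centreFixing φ) (from (aut ψ)) x ⟩
      bar (to (aut φ)) (bar (from (aut ψ)) x)      ≡⟨ bar-φ≗bar-ψ _ ⟩
      bar (to (aut ψ)) (bar (from (aut ψ)) x)      ≡⟨ bar-to∘from ψ x ⟩
      x                                            ∎
    inner : Σ Inn λ χ → to (aut φ) ∘ from (aut ψ) ≗ to (innAut χ)
    inner = acts-trivially⇒inner (∘-centreFixing (to-centreFixing φ) (from-centreFixing ψ)) bar-φψ⁻¹≗id

  ≈Out⇒same-bar : ∀ (φ ψ : Aut0) → φ ≈Out ψ → bar (to (aut φ)) ≗ bar (to (aut ψ))
  ≈Out⇒same-bar φ ψ (χ , φ≗χψ) x = begin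
    bar (to (aut φ)) x                                ≡⟨ bar-cong φ≗χψ x ⟩
    bar (to (innAut χ) ∘ to (aut ψ)) x                ≡⟨ bar-∘ (inner-centreFixing χ) (to (aut ψ)) x ⟩
    bar (to (innAut χ)) (bar (to (aut ψ)) x)          ≡⟨ inner-bar χ _ ⟩
    bar (to (aut ψ)) x                                ∎

  conjugate-inner : ∀ (φ : Aut0) (χ : Inn) → Σ H λ k →
                    ∀ g → to (aut φ) (to (innAut χ) (from (aut φ) g)) ≡ k · g · inv k
  conjugate-inner φ χ = conjugator (proj₁ inner) , λ g → ≡.trans (proj₂ inner g) (isConj (proj₁ inner) g)
    where
    bar-φχφ⁻¹≗id : bar (to (aut φ) ∘ to (innAut χ) ∘ from (aut φ)) ≗ id
    bar-φχφ⁻¹≗id x = begin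
      bar (to (aut φ) ∘ to (innAut χ) ∘ from (aut φ)) x
        ≡⟨ bar-∘ (to-centreFixing φ) (to (innAut χ) ∘ from (aut φ)) x ⟩
      bar (to (aut φ)) (bar (to (innAut χ) ∘ from (aut φ)) x)
        ≡⟨ ≡.cong (bar (to (aut φ))) (bar-∘ (inner-centreFixing χ) (from (aut φ)) x) ⟩
      bar (to (aut φ)) (bar (to (innAut χ)) (bar (from (aut φ)) x))
        ≡⟨ ≡.cong (bar (to (aut φ))) (inner-bar χ _) ⟩
      bar (to (aut φ)) (bar (from (aut φ)) x)
        ≡⟨ bar-to∘from φ x ⟩
      x
        ∎
    inner : Σ Inn λ χ′ → to (aut φ) ∘ to (innAut χ) ∘ from (aut φ) ≗ to (innAut χ′)
    inner = acts-trivially⇒inner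
      (∘-centreFixing (to-centreFixing φ) (∘-centreFixing (inner-centreFixing χ) (from-centreFixing φ)))
      bar-φχφ⁻¹≗id

  from-cong : ∀ {φ ψ : Aut} → φ ≈Aut ψ → from φ ≗ from ψ
  from-cong {φ} {ψ} φ≗ψ g = begin
    from φ g                 ≡⟨ ≡.cong (from φ) (to∘from ψ g) ⟨
    from φ (to ψ (from ψ g)) ≡⟨ ≡.cong (from φ) (φ≗ψ _) ⟨
    from φ (to φ (from ψ g)) ≡⟨ from∘to φ _ ⟩
    from ψ g                 ∎

  from-∘ : ∀ {χ φ ψ} → CompAut0 χ φ ψ → from (aut χ) ≗ from (aut ψ) ∘ from (aut φ)
  from-∘ {χ} {φ} {ψ} χ≗φψ g = begin
    from (aut χ) g                            ≡⟨ ≡.cong (from (aut χ)) φψ[ψ⁻¹φ⁻¹g]≡g ⟨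
    from (aut χ) (to (aut φ) (to (aut ψ) u))  ≡⟨ ≡.cong (from (aut χ)) (χ≗φψ u) ⟨
    from (aut χ) (to (aut χ) u)               ≡⟨ from∘to (aut χ) u ⟩
    u                                         ∎
    where
    u : H
    u = from (aut ψ) (from (aut φ) g)
    φψ[ψ⁻¹φ⁻¹g]≡g : to (aut φ) (to (aut ψ) u) ≡ g
    φψ[ψ⁻¹φ⁻¹g]≡g = ≡.trans (≡.cong (to (aut φ)) (to∘from (aut ψ) _)) (to∘from (aut φ) g)

  bar-from-∘ : ∀ {χ φ ψ} → CompAut0 χ φ ψ → bar (from (aut χ)) ≗ bar (from (aut ψ)) ∘ bar (from (aut φ))
  bar-from-∘ {χ} {φ} {ψ} χ≗φψ x =
    ≡.trans (bar-cong (from-∘ {χ} {φ} {ψ} χ≗φψ) x) (bar-∘ (from-centreFixing ψ) (from (aut φ)) x)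

  bar-to≗⇒bar-from≗ : ∀ (φ ψ : Aut0) → bar (to (aut φ)) ≗ bar (to (aut ψ)) →
                      bar (from (aut φ)) ≗ bar (from (aut ψ))
  bar-to≗⇒bar-from≗ φ ψ = inverses-agree (bar-from∘to φ) (bar-to∘from ψ)

  bar-from≗⇒bar-to≗ : ∀ (φ ψ : Aut0) → bar (from (aut φ)) ≗ bar (from (aut ψ)) →
                      bar (to (aut φ)) ≗ bar (to (aut ψ))
  bar-from≗⇒bar-to≗ φ ψ = inverses-agree (bar-to∘from φ) (bar-from∘to ψ)

  determined-by-bar-eta : ∀ {f f′} → IsCentreFixingHom f → IsCentreFixingHom f′ →
                          bar f ≗ bar f′ → eta f ≗ eta f′ → f ≗ f′
  determined-by-bar-eta {f} {f′} f-cf f′-cf bar≗ eta≗ g = begin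
    f g                        ≡⟨ CentreFixingHom.representation f-cf g ⟩
    induced (bar f) (eta f) g        ≡⟨ induced-cong bar≗ eta≗ g ⟩
    induced (bar f′) (eta f′) g      ≡⟨ CentreFixingHom.representation f′-cf g ⟨
    f′ g                       ∎

  ≈Out-id⇒inner : ∀ (φ ψ : Aut0) → to (aut ψ) ≗ id → φ ≈Out ψ → Σ Inn λ χ → aut φ ≈Aut innAut χ
  ≈Out-id⇒inner φ ψ ψ≗id (χ , φ≗χψ) = χ , λ g → ≡.trans (φ≗χψ g) (≡.cong (to (innAut χ)) (ψ≗id g))

  inner⇒≈Out-id : ∀ (φ : Aut0) (χ : Inn) → aut φ ≈Aut innAut χ → ∀ (ψ : Aut0) → to (aut ψ) ≗ id → φ ≈Out ψ
  inner⇒≈Out-id φ χ φ≗χ ψ ψ≗id = χ , λ g → ≡.trans (φ≗χ g) (≡.cong (to (innAut χ)) (≡.sym (ψ≗id g)))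

  projSD-kernel : ∀ s → IsSD s → projSD s ≈Sp idSp →
                  Σ (AB → C.Carrier) λ η → IsHom η × s ≈SD inclSD η
  projSD-kernel (η , α) (η+ , _) α≗id = η , η+ , (λ _ → ≡.refl) , α≗id

  Θ𝒟-inner : ∀ (χ : Inn) (φ : Aut0) → aut φ ≈Aut innAut χ → Θ𝒟 φ ≈SD inclSD (Θ₁ χ)
  Θ𝒟-inner χ φ φ≗χ = eta-cong φ≗χ , λ x → begin
    bar (from (aut φ)) x
      ≡⟨ ≡.cong (bar (from (aut φ))) (≡.trans (bar-cong φ≗χ x) (inner-bar χ x)) ⟨
    bar (from (aut φ)) (bar (to (aut φ)) x)
      ≡⟨ bar-from∘to φ x ⟩
    x
      ∎

  Θ₁-antiIso : AntiIso Inn (λ χ χ′ → innAut χ ≈Aut innAut χ′) CompInn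
                       (AB → C.Carrier) IsHom _≈Hom_ _+Hom_ Θ₁
  Θ₁-antiIso = record
    { lands      = λ χ → CentreFixingHom.eta-additive (inner-centreFixing χ)
    ; respects   = λ χ χ′ → eta-cong {to (innAut χ)} {to (innAut χ′)}
    ; antiHom    = λ χ φ ψ χ≗φψ x → begin
        eta (to (innAut χ)) x
          ≡⟨ eta-cong χ≗φψ x ⟩
        eta (to (innAut φ) ∘ to (innAut ψ)) x
          ≡⟨ eta-∘ (inner-centreFixing φ) (inner-centreFixing ψ) x ⟩
        eta (to (innAut ψ)) x ∙ eta (to (innAut φ)) (bar (to (innAut ψ)) x)
          ≡⟨ ≡.cong (λ y → eta (to (innAut ψ)) x ∙ eta (to (innAut φ)) y) (inner-bar ψ x) ⟩
        eta (to (innAut ψ)) x ∙ eta (to (innAut φ)) x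
          ∎
    ; injective  = λ χ χ′ → determined-by-bar-eta (inner-centreFixing χ) (inner-centreFixing χ′)
                              (λ x → ≡.trans (inner-bar χ x) (≡.sym (inner-bar χ′ x)))
    ; surjective = λ η η+ → let (k , η≗δk) = δ-surjective η η+ in
                            conjugation k , λ x → ≡.trans (eta-induced id (δ k) x) (≡.sym (η≗δk x))
    }

  Θ𝒟-antiIso : AntiIso Aut0 (λ φ ψ → aut φ ≈Aut aut ψ) CompAut0 SD IsSD _≈SD_ _⋆_ Θ𝒟
  Θ𝒟-antiIso = record
    { lands      = λ φ → CentreFixingHom.eta-additive (to-centreFixing φ) , swap-isSp (barMap-isSp φ)
    ; respects   = λ φ ψ φ≗ψ → eta-cong φ≗ψ , bar-cong (from-cong {aut φ} {aut ψ} φ≗ψ)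
    ; antiHom    = λ χ φ ψ χ≗φψ →
        (λ x → ≡.trans (eta-cong χ≗φψ x) (eta-∘ (to-centreFixing φ) (to-centreFixing ψ) x)) ,
        bar-from-∘ {χ} {φ} {ψ} χ≗φψ
    ; injective  = λ φ ψ (eta≗ , bar-from≗) →
        determined-by-bar-eta (to-centreFixing φ) (to-centreFixing ψ) (bar-from≗⇒bar-to≗ φ ψ bar-from≗) eta≗
    ; surjective = λ (η , α) (η+ , α-sp) →
        automorphism (swap α) (swap-isSp α-sp) η η+ , eta-induced (bw α) η , (λ _ → ≡.refl)
    }

  trivial-isHom : IsHom (λ _ → ε)
  trivial-isHom _ _ = ≡.sym (identityˡ ε)

  Θ̃-antiIso : AntiIso Aut0 _≈Out_ CompAut0 ABMap IsSp _≈Sp_ _∘Sp_ Θ̃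
  Θ̃-antiIso = record
    { lands      = λ φ → swap-isSp (barMap-isSp φ)
    ; respects   = λ φ ψ φ≈ψ → bar-to≗⇒bar-from≗ φ ψ (≈Out⇒same-bar φ ψ φ≈ψ)
    ; antiHom    = λ χ φ ψ → bar-from-∘ {χ} {φ} {ψ}
    ; injective  = λ φ ψ bar-from≗ → same-bar⇒≈Out φ ψ (bar-from≗⇒bar-to≗ φ ψ bar-from≗)
    ; surjective = λ α α-sp → automorphism (swap α) (swap-isSp α-sp) (λ _ → ε) trivial-isHom , (λ _ → ≡.refl)
    }

  Θ̄-iso : Iso Aut0 _≈Out_ CompAut0 ABMap IsSp _≈Sp_ _∘Sp_ Θ̄
  Θ̄-iso = record
    { lands      = barMap-isSp
    ; respects   = ≈Out⇒same-bar
    ; hom        = λ χ φ ψ χ≗φψ x → ≡.trans (bar-cong χ≗φψ x) (bar-∘ (to-centreFixing φ) (to (aut ψ)) x)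
    ; injective  = same-bar⇒≈Out
    ; surjective = λ α α-sp → automorphism α α-sp (λ _ → ε) trivial-isHom , (λ _ → ≡.refl)
    }

theorem6p3 : ∀ {c ℓ} (R : CommutativeRing c ℓ) (A B : Module R 0ℓ 0ℓ)
    (C : AbelianGroup 0ℓ 0ℓ) (r : ℕ)
    (lam : Module.Carrierᴹ A → Module.Carrierᴹ B → AbelianGroup.Carrier C) →
    FiniteModule A → FiniteModule B →
    ¬ (∀ a → a ≡ Module.0ᴹ A) →
    IsCyclicOfOrder C r → Odd r →
    Heisenberg.Biadditive R A B C r lam →
    Heisenberg.Balanced R A B C r lam →
    Heisenberg.NonDegenerate R A B C r lam →
    Heisenberg.Theorem6p3Conclusion R A B C r lam
theorem6p3 R A B C r lam finA finB _ cyclic odd biadditive _ nondegenerate =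
    inner-isAut0
  , conjugate-inner
  , ≈Out-id⇒inner
  , inner⇒≈Out-id
  , (λ η η+ → η+ , idSp-isSp)
  , projSD-kernel
  , (λ _ _ → ≡.refl)
  , (λ α α-sp → ((λ _ → ε) , α) , (trivial-isHom , α-sp) , (λ _ → ≡.refl))
  , (λ _ _ _ → ≡.refl)
  , Θ𝒟-inner
  , (λ _ _ → ≡.refl)
  , Θ₁-antiIso
  , Θ𝒟-antiIso
  , Θ̃-antiIso
  , Θ̄-iso
  where
  open HeisenbergProperties R A B C r lam finA finB cyclic odd biadditive nondegenerate
  open AbelianGroup C using (ε)
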